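{- Let $N>1$ be an integer. Let $\phi_N:X_0(N^2)\to X_0(N)$ be the $N$-sheeted covering induced by $\Gamma_0(N^2)<\Gamma_0(N)$, and $\phi_N':X_0(N^2)\to X_0(N)'$ the covering induced by $\Gamma_0(N^2)<\Gamma_0(N)'$. Then, as divisors (formal sums of cusps with multiplicities) on $X_0(N^2)$: $$\phi_N^{ -1}\bigl([\tfrac11]_N\bigr)=N\cdot[\tfrac11]_{N^2},\qquad \phi_N^{ -1}\bigl([\tfrac1N]_N\bigr)=\sum_{\substack{d\mid N^2,\ N\mid d}}\ \sum_{a}[\tfrac ad]_{N^2},$$ $$\phi_N'^{ -1}\bigl([\tfrac11]_N/N\bigr)=\sum_{d\mid N}\ \sum_{a}[\tfrac ad]_{N^2},\qquad \phi_N'^{ -1}\bigl([\tfrac1N]_N/N\bigr)=N\cdot[\tfrac1{N^2}]_{N^2},$$ where in each double sum the inner sum runs over the $\varphi(\gcd(d,N^2/d))$ distinct cusps of $X_0(N^2)$ of the form $[\frac ad]_{N^2}$ (so each sum has $N$ terms in all).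
   Context: $\Gamma$ is the modular group $SL(2,\mathbb{Z})/\{\pm I\}$ acting on the upper half-plane $\mathfrak{H}$ and on $\mathfrak{H}^*=\mathfrak{H}\cup\mathbb{Q}\cup\{i\infty\}$; $\Gamma_0(M)$ is the subgroup of classes of matrices $\begin{pmatrix}a&b\\c&d\end{pmatrix}$ with $M\mid c$, and $X_0(M)=\Gamma_0(M)\backslash\mathfrak{H}^*$. Cusps of $X_0(M)$ are $\Gamma_0(M)$-equivalence classes of points of $\mathbb{P}^1(\mathbb{Q})$; $[\frac ad]_M$ denotes the class of $a/d$. Every class has a representative $a/d$ with $d\mid M$, $\gcd(a,d)=1$, where $d$ is an invariant of the class and $a$ is determined modulo $\gcd(d,M/d)$ (subject to being coprime to $d$), so there are $\varphi(\gcd(d,M/d))$ cusps with a given $d$ ($\varphi$ is Euler's totient). $[\frac11]_M$ is the class of $0$ and $[\frac1M]_M$ the class of $i\infty$. Let $w_{N^2}:\tau\mapsto -1/(N^2\tau)$ and $\Gamma_0(N)':=w_{N^2}^{ -1}\Gamma_0(N)w_{N^2}$ (equivalently the conjugate of $\Gamma_0(N)$ by $\tau\mapsto N\tau$), a subgroup of $PSL(2,\mathbb{R})$ containing $\Gamma_0(N^2)$, and $X_0(N)'=\Gamma_0(N)'\backslash\mathfrak{H}^*$. Its cusps are the sets $[\tau]_N/N:=\{x/N: x\in[\tau]_N\}$ for cusps $[\tau]_N$ of $X_0(N)$. Preimages are taken as divisors, each point counted with its ramification index. -}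

module Defs where

open import Data.Nat as ℕ using (ℕ; _<_)
open import Data.Nat.Divisibility using (_∣_)
open import Data.Nat.GCD using (gcd)
open import Data.Integer as ℤ using (ℤ; +_)
open import Data.Rational as ℚ using (ℚ; 0ℚ; 1ℚ; _+_; _*_; -_; _/_)
open import Data.Product using (Σ; ∃; ∃-syntax; _×_; _,_)
open import Data.Sum using (_⊎_)
open import Relation.Binary.PropositionalEquality using (_≡_)
open import Relation.Nullary using (¬_)
open import Function.Bundles using (_⇔_)

ℤ→ℚ : ℤ → ℚ
ℤ→ℚ z = z / 1

ℕ→ℚ : ℕ → ℚ
ℕ→ℚ n = (+ n) / 1

IsInt : ℚ → Set
IsInt x = ∃[ z ] x ≡ ℤ→ℚ z

record M2 : Set where
  constructor mat
  field
    a b c d : ℚ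
open M2 public

_⊗_ : M2 → M2 → M2
mat a₁ b₁ c₁ d₁ ⊗ mat a₂ b₂ c₂ d₂ =
  mat (a₁ * a₂ + b₁ * c₂) (a₁ * b₂ + b₁ * d₂)
      (c₁ * a₂ + d₁ * c₂) (c₁ * b₂ + d₁ * d₂)

det : M2 → ℚ
det (mat a b c d) = a * d + - (b * c)

neg : M2 → M2
neg (mat a b c d) = mat (- a) (- b) (- c) (- d)

-- adjugate; it is the inverse for determinant-1 matrices
adj : M2 → M2
adj (mat a b c d) = mat d (- b) (- c) a

T : ℚ → M2
T h = mat 1ℚ h 0ℚ 1ℚ

-- a "group" is given by the predicate of membership of its SL(2,ℝ)
-- matrices (it contains both lifts ±γ of each of its PSL elements)
Grp : Set₁
Grp = M2 → Set

SL2Z : Grp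
SL2Z m = IsInt (a m) × IsInt (b m) × IsInt (c m) × IsInt (d m) × det m ≡ 1ℚ

Γ₀ : ℕ → Grp
Γ₀ M m = SL2Z m × ∃[ k ] c m ≡ ℤ→ℚ (k ℤ.* (+ M))

αN : ℕ → M2
αN N = mat (ℕ→ℚ N) 0ℚ 0ℚ 1ℚ

-- Γ₀(N)' = α⁻¹ Γ₀(N) α, i.e. m ∈ Γ₀(N)' iff α m = γ α for some γ ∈ Γ₀(N)
Γ₀' : ℕ → Grp
Γ₀' N m = ∃[ γ ] Γ₀ N γ × (αN N ⊗ m) ≡ (γ ⊗ αN N)

-- ℙ¹(ℚ): homogeneous coordinates (p : q) represents p/q  ((1 : 0) = i∞)

Pt : Set
Pt = ℚ × ℚ

ValidPt : Pt → Set
ValidPt (p , q) = ¬ (p ≡ 0ℚ × q ≡ 0ℚ)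

_∼_ : Pt → Pt → Set
(p , q) ∼ (p' , q') = p * q' ≡ p' * q

act : M2 → Pt → Pt
act (mat a b c d) (p , q) = (a * p + b * q , c * p + d * q)

∞pt : Pt
∞pt = (1ℚ , 0ℚ)

frac : ℤ → ℕ → Pt
frac a d = (ℤ→ℚ a , ℕ→ℚ d)

-- x and y are equivalent under G (same cusp of G\ℌ*)
Equiv : Grp → Pt → Pt → Set
Equiv G x y = ∃[ γ ] G γ × act γ x ∼ y

InCusp : ℕ → ℤ → ℕ → Pt → Set
InCusp M a d x = Equiv (Γ₀ M) x (frac a d)

divN : ℕ → Pt → Pt
divN N (p , q) = (p , ℕ→ℚ N * q)

TransIn : Grp → Pt → ℚ → Set
TransIn G s h = ∃[ g ] SL2Z g × act g ∞pt ∼ s ×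
  (G (g ⊗ (T h ⊗ adj g)) ⊎ G (neg (g ⊗ (T h ⊗ adj g))))

IsWidth : Grp → Pt → ℚ → Set
IsWidth G s h = 0ℚ ℚ.< h × TransIn G s h ×
  (∀ h' → 0ℚ ℚ.< h' → TransIn G s h' → h ℚ.≤ h')

RamIndex : (H G : Grp) → Pt → ℕ → Set
RamIndex H G s e = ∃[ hG ] ∃[ hH ] IsWidth G s hG × IsWidth H s hH ×
  hH ≡ ℕ→ℚ e * hG

-- The preimage (as a divisor, points counted with ramification index)
-- under the covering H\ℌ* → G\ℌ* of the cusp whose set of points is
-- `fiber` equals  coef · Σ (cusps of H\ℌ* whose points satisfy `supp`),
-- each such cusp counted once.
PreimageIs : (H G : Grp) (fiber : Pt → Set) (coef : ℕ) (supp : Pt → Set) → Set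
PreimageIs H G fiber coef supp =
  ∀ y → ValidPt y → (fiber y ⇔ supp y) × (fiber y → RamIndex H G y coef)

CuspWithDen : ℕ → (ℕ → Set) → Pt → Set
CuspWithDen M P y = ∃[ d ] ∃[ a ] d ∣ M × P d × gcd (ℤ.∣ a ∣) d ≡ 1 × InCusp M a d y

-- y ∈ [a/d]_N / N  (the cusp of X₀(N)' given by the set {x/N : x ∈ [a/d]_N})
InCuspDivN : ℕ → ℤ → ℕ → Pt → Set
InCuspDivN N a d y = ∃[ x ] ValidPt x × InCusp N a d x × y ∼ divN N x

-- Every point is written as a reduced fraction u/v.  Then u/v ∈ [1/1]_M iff gcd(v, M) = 1,
-- u/v ∈ [1/M]_M iff M ∣ v, and u/v ∈ [a/d]_M for some a as soon as d ∣ v, d ∣ M and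
-- gcd(v/d, M/d) = 1, by completing a primitive bottom row (kM, δ) with kMu + δv = d to a
-- matrix of Γ₀(M).  The translations of a group fixing u/v are the g Tʰ g⁻¹ with (u, v) the
-- first column of g; those in Γ₀(M) are exactly the ones with h ∈ ℤ and M ∣ v²h, which gives
-- all widths for Γ₀(N) and Γ₀(N²).  Those in Γ₀(N)′ have N·h ∈ ℤ, so its width at the points
-- of [1/N]_N/N is 1/N, while at the points of [1/1]_N/N they already lie in Γ₀(N²).  The
-- ramification indices are the quotients of these widths.

module Submission where

open import Defs
open import Data.Nat using (ℕ; _*_; _<_)
open import Data.Nat.Divisibility using (_∣_)
open import Data.Integer using (+_)
open import Data.Product using (_×_)

open import Algebra.Bundles using (CommutativeMonoid)
open import Data.Empty using (⊥-elim)
open import Data.Integer as ℤ using (ℤ; -[1+_]; +[1+_]; 0ℤ; 1ℤ)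
open import Data.Integer.Divisibility.Signed
  using (divides; ∣ᵤ⇒∣; ∣⇒∣ᵤ; ∣m∣n⇒∣m+n; ∣n⇒∣m*n; *-cancelˡ-∣) renaming (_∣_ to _∣ᶻ_)
import Data.Integer.Properties as ℤP
open import Data.Integer.Tactic.RingSolver using () renaming (ring to ℤ-ring)
open import Data.List using (_∷_; [])
open import Data.Nat as ℕ using (zero; suc)
import Data.Nat.Coprimality as ℕC
import Data.Nat.Divisibility as ℕD
import Data.Nat.GCD as ℕG
open import Data.Nat.Induction using (<-wellFounded)
import Data.Nat.Properties as ℕP
open import Data.Nat.Tactic.RingSolver using () renaming (ring to ℕ-ring)
open import Data.Product using (Σ; ∃-syntax; ∃₂; _,_; proj₁; proj₂; map₂)
open import Data.Rational as ℚ using (ℚ; 0ℚ; 1ℚ; mkℚ; ↥_)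
import Data.Rational.Properties as ℚP
open import Data.Sum using (inj₁; inj₂; [_,_]′) renaming (map to ⊎-map)
open import Function using (id; _∘_)
open import Function.Bundles using (mk⇔)
open import Induction.WellFounded using (Acc; acc)
open import Level using (0ℓ)
open import Relation.Binary.PropositionalEquality
open import Relation.Nullary using (yes; no)
open import Relation.Nullary.Decidable using (dec⇒maybe)
open import Relation.Unary using (_⊆_)
open import Tactic.RingSolver using (solve; solve-∀)
open import Tactic.RingSolver.Core.AlmostCommutativeRing using (AlmostCommutativeRing; fromCommutativeRing)
open import Algebra.Properties.CommutativeSemigroup (CommutativeMonoid.commutativeSemigroup ℚP.*-1-commutativeMonoid)
  using (x∙yz≈y∙xz)

open ≡-Reasoning

ℚ-ring : AlmostCommutativeRing 0ℓ 0ℓ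
ℚ-ring = fromCommutativeRing ℚP.+-*-commutativeRing (λ x → dec⇒maybe (0ℚ ℚP.≟ x))

ι : ℤ → ℚ
ι = ℤ→ℚ

ι≡mkℚ : ∀ z → ι z ≡ mkℚ z 0 (ℕC.sym (ℕC.1-coprimeTo ℤ.∣ z ∣))
ι≡mkℚ (+ n)    = ℚP.normalize-coprime (ℕC.sym (ℕC.1-coprimeTo n))
ι≡mkℚ -[1+ n ] = cong ℚ.-_ (ℚP.normalize-coprime (ℕC.sym (ℕC.1-coprimeTo (suc n))))

ι-homo-+ : ∀ i j → ι (i ℤ.+ j) ≡ ι i ℚ.+ ι j
ι-homo-+ i j rewrite ι≡mkℚ i | ι≡mkℚ j =
  cong (ℚ._/ 1) (sym (cong₂ ℤ._+_ (ℤP.*-identityʳ i) (ℤP.*-identityʳ j)))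

ι-homo-* : ∀ i j → ι (i ℤ.* j) ≡ ι i ℚ.* ι j
ι-homo-* i j rewrite ι≡mkℚ i | ι≡mkℚ j = refl

ι-homo‿- : ∀ i → ι (ℤ.- i) ≡ ℚ.- ι i
ι-homo‿- (+ zero)  = refl
ι-homo‿- +[1+ n ]  = refl
ι-homo‿- i@(-[1+ n ]) = trans (ι≡mkℚ _) (cong ℚ.-_ (sym (ι≡mkℚ i)))

ι-*₃ : ∀ a b c → ι (a ℤ.* b ℤ.* c) ≡ ι a ℚ.* ι b ℚ.* ι c
ι-*₃ a b c = trans (ι-homo-* (a ℤ.* b) c) (cong (ℚ._* ι c) (ι-homo-* a b))

ℕ→ℚ-homo-* : ∀ m n → ℕ→ℚ (m ℕ.* n) ≡ ℕ→ℚ m ℚ.* ℕ→ℚ n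
ℕ→ℚ-homo-* m n = trans (cong ι (ℤP.pos-* m n)) (ι-homo-* (+ m) (+ n))

ι-injective : ∀ {i j} → ι i ≡ ι j → i ≡ j
ι-injective {i} {j} eq = begin
  i           ≡⟨ cong ↥_ (ι≡mkℚ i) ⟨
  ↥ ι i       ≡⟨ cong ↥_ eq ⟩
  ↥ ι j       ≡⟨ cong ↥_ (ι≡mkℚ j) ⟩
  j           ∎

ι-mono-≤ : ∀ {i j} → i ℤ.≤ j → ι i ℚ.≤ ι j
ι-mono-≤ {i} {j} i≤j rewrite ι≡mkℚ i | ι≡mkℚ j =
  ℚ.*≤* (subst₂ ℤ._≤_ (sym (ℤP.*-identityʳ i)) (sym (ℤP.*-identityʳ j)) i≤j)

ι-mono-< : ∀ {i j} → i ℤ.< j → ι i ℚ.< ι j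
ι-mono-< {i} {j} i<j rewrite ι≡mkℚ i | ι≡mkℚ j =
  ℚ.*<* (subst₂ ℤ._<_ (sym (ℤP.*-identityʳ i)) (sym (ℤP.*-identityʳ j)) i<j)

ι-cancel-< : ∀ {i j} → ι i ℚ.< ι j → i ℤ.< j
ι-cancel-< {i} {j} i<j with subst₂ ℚ._<_ (ι≡mkℚ i) (ι≡mkℚ j) i<j
... | ℚ.*<* i*1<j*1 = subst₂ ℤ._<_ (ℤP.*-identityʳ i) (ℤP.*-identityʳ j) i*1<j*1

ℚ-neg-involutive : ∀ x → ℚ.- ℚ.- x ≡ x
ℚ-neg-involutive = solve-∀ ℚ-ring

*-cancelˡ-≡ : ∀ {a x y} → a ≢ 0ℚ → a ℚ.* x ≡ a ℚ.* y → x ≡ y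
*-cancelˡ-≡ {a} {x} {y} a≢0 ax≡ay = trans (sym (undo x)) (trans (cong (ℚ.1/ a ℚ.*_) ax≡ay) (undo y))
  where
  instance
    a-nonZero : ℚ.NonZero a
    a-nonZero = ℚ.≢-nonZero a≢0
  undo : ∀ z → ℚ.1/ a ℚ.* (a ℚ.* z) ≡ z
  undo z = begin
    ℚ.1/ a ℚ.* (a ℚ.* z)  ≡⟨ ℚP.*-assoc (ℚ.1/ a) a z ⟨
    ℚ.1/ a ℚ.* a ℚ.* z    ≡⟨ cong (ℚ._* z) (ℚP.*-inverseˡ a) ⟩
    1ℚ ℚ.* z              ≡⟨ ℚP.*-identityˡ z ⟩
    z                     ∎

*-cancel-square : ∀ {a x y} → a ≢ 0ℚ → a ℚ.* a ℚ.* x ≡ a ℚ.* a ℚ.* y → x ≡ y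
*-cancel-square {a} {x} {y} a≢0 aax≡aay =
  *-cancelˡ-≡ a≢0 (*-cancelˡ-≡ a≢0 (trans (sym (ℚP.*-assoc a a x)) (trans aax≡aay (ℚP.*-assoc a a y))))

IsInt-+ : ∀ {x y} → IsInt x → IsInt y → IsInt (x ℚ.+ y)
IsInt-+ (i , refl) (j , refl) = i ℤ.+ j , sym (ι-homo-+ i j)

IsInt-* : ∀ {x y} → IsInt x → IsInt y → IsInt (x ℚ.* y)
IsInt-* (i , refl) (j , refl) = i ℤ.* j , sym (ι-homo-* i j)

IsInt-‿- : ∀ {x} → IsInt x → IsInt (ℚ.- x)
IsInt-‿- (i , refl) = ℤ.- i , sym (ι-homo‿- i)


Coprime : ℤ → ℤ → Set
Coprime x y = ∃₂ λ s t → s ℤ.* x ℤ.+ t ℤ.* y ≡ 1ℤ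

coprime-sym : ∀ {x y} → Coprime x y → Coprime y x
coprime-sym {x} {y} (s , t , eq) = t , s , trans (ℤP.+-comm (t ℤ.* y) (s ℤ.* x)) eq

coprime-*ʳ : ∀ {x y z} → Coprime x y → Coprime x z → Coprime x (y ℤ.* z)
coprime-*ʳ {x} {y} {z} (s , t , eq) (s′ , t′ , eq′) =
  s ℤ.* s′ ℤ.* x ℤ.+ s ℤ.* t′ ℤ.* z ℤ.+ t ℤ.* y ℤ.* s′ , t ℤ.* t′ , (begin
    (s ℤ.* s′ ℤ.* x ℤ.+ s ℤ.* t′ ℤ.* z ℤ.+ t ℤ.* y ℤ.* s′) ℤ.* x ℤ.+ t ℤ.* t′ ℤ.* (y ℤ.* z)
      ≡⟨ solve (x ∷ y ∷ z ∷ s ∷ t ∷ s′ ∷ t′ ∷ []) ℤ-ring ⟩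
    (s ℤ.* x ℤ.+ t ℤ.* y) ℤ.* (s′ ℤ.* x ℤ.+ t′ ℤ.* z)
      ≡⟨ cong₂ ℤ._*_ eq eq′ ⟩
    1ℤ ∎)

coprime-*ˡ : ∀ {x y z} → Coprime x z → Coprime y z → Coprime (x ℤ.* y) z
coprime-*ˡ x⊥z y⊥z = coprime-sym (coprime-*ʳ (coprime-sym x⊥z) (coprime-sym y⊥z))

coprime-∣ʳ : ∀ {x y z} → Coprime x y → z ∣ᶻ y → Coprime x z
coprime-∣ʳ {x} {z = z} (s , t , eq) (divides q refl) =
  s , t ℤ.* q , trans (cong (λ w → s ℤ.* x ℤ.+ w) (ℤP.*-assoc t q z)) eq

coprime-∣ˡ : ∀ {x y z} → Coprime x y → z ∣ᶻ x → Coprime z y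
coprime-∣ˡ x⊥y z∣x = coprime-sym (coprime-∣ʳ (coprime-sym x⊥y) z∣x)

coprime-+* : ∀ {x y} k → Coprime x y → Coprime (x ℤ.+ k ℤ.* y) y
coprime-+* {x} {y} k (s , t , eq) = s , t ℤ.- s ℤ.* k , (begin
  s ℤ.* (x ℤ.+ k ℤ.* y) ℤ.+ (t ℤ.- s ℤ.* k) ℤ.* y ≡⟨ solve (x ∷ y ∷ k ∷ s ∷ t ∷ []) ℤ-ring ⟩
  s ℤ.* x ℤ.+ t ℤ.* y                              ≡⟨ eq ⟩
  1ℤ                                               ∎)

coprime-divisor : ∀ {a m b} → Coprime a m → m ∣ᶻ a ℤ.* b → m ∣ᶻ b
coprime-divisor {a} {m} {b} (s , t , eq) (divides k ab≡km) = divides (s ℤ.* k ℤ.+ t ℤ.* b) (begin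
  b                                  ≡⟨ ℤP.*-identityˡ b ⟨
  1ℤ ℤ.* b                           ≡⟨ cong (ℤ._* b) eq ⟨
  (s ℤ.* a ℤ.+ t ℤ.* m) ℤ.* b        ≡⟨ solve (a ∷ m ∷ b ∷ s ∷ t ∷ []) ℤ-ring ⟩
  s ℤ.* (a ℤ.* b) ℤ.+ t ℤ.* b ℤ.* m  ≡⟨ cong (λ w → s ℤ.* w ℤ.+ t ℤ.* b ℤ.* m) ab≡km ⟩
  s ℤ.* (k ℤ.* m) ℤ.+ t ℤ.* b ℤ.* m  ≡⟨ solve (m ∷ b ∷ s ∷ t ∷ k ∷ []) ℤ-ring ⟩
  (s ℤ.* k ℤ.+ t ℤ.* b) ℤ.* m        ∎)

coprime-‿-ˡ : ∀ {x y} → Coprime x y → Coprime (ℤ.- x) y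
coprime-‿-ˡ {x} {y} (s , t , eq) = ℤ.- s , t , trans (cong (ℤ._+ t ℤ.* y) (neg*neg s x)) eq
  where
  neg*neg : ∀ a b → ℤ.- a ℤ.* ℤ.- b ≡ a ℤ.* b
  neg*neg = solve-∀ ℤ-ring

coprime-1ˡ : ∀ x → Coprime 1ℤ x
coprime-1ˡ x = 1ℤ , 0ℤ , refl

coprime-1ʳ : ∀ x → Coprime x 1ℤ
coprime-1ʳ x = 0ℤ , 1ℤ , refl

coprime-N² : ∀ {x N} → Coprime x (+ N) → Coprime x (+ (N ℕ.* N))
coprime-N² {x} {N} x⊥N = subst (Coprime x) (sym (ℤP.pos-* N N)) (coprime-*ʳ x⊥N x⊥N)

unit-square : ∀ l m → l ℤ.* m ≡ 1ℤ → l ℤ.* l ≡ 1ℤ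
unit-square l m lm≡1 =
  square l (ℕP.m*n≡1⇒m≡1 ℤ.∣ l ∣ ℤ.∣ m ∣ (trans (sym (ℤP.abs-* l m)) (cong ℤ.∣_∣ lm≡1)))
  where
  square : ∀ l → ℤ.∣ l ∣ ≡ 1 → l ℤ.* l ≡ 1ℤ
  square (+ 1)    _ = refl
  square -[1+ 0 ] _ = refl

coprime-proportional : ∀ {u v A C} → Coprime u v → Coprime A C → A ℤ.* v ≡ u ℤ.* C →
                       ∃[ l ] A ≡ l ℤ.* u × C ≡ l ℤ.* v × l ℤ.* l ≡ 1ℤ
coprime-proportional {u} {v} {A} {C} (s , t , su+tv≡1) (s′ , t′ , s′A+t′C≡1) Av≡uC =
  l , A≡lu , C≡lv , unit-square l (s′ ℤ.* u ℤ.+ t′ ℤ.* v) (begin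
    l ℤ.* (s′ ℤ.* u ℤ.+ t′ ℤ.* v)        ≡⟨ distrib l s′ u t′ v ⟩
    s′ ℤ.* (l ℤ.* u) ℤ.+ t′ ℤ.* (l ℤ.* v) ≡⟨ cong₂ (λ x y → s′ ℤ.* x ℤ.+ t′ ℤ.* y) A≡lu C≡lv ⟨
    s′ ℤ.* A ℤ.+ t′ ℤ.* C                 ≡⟨ s′A+t′C≡1 ⟩
    1ℤ                                    ∎)
  where
  l : ℤ
  l = s ℤ.* A ℤ.+ t ℤ.* C
  distrib : ∀ l s′ u t′ v → l ℤ.* (s′ ℤ.* u ℤ.+ t′ ℤ.* v) ≡ s′ ℤ.* (l ℤ.* u) ℤ.+ t′ ℤ.* (l ℤ.* v)
  distrib = solve-∀ ℤ-ring
  A≡lu : A ≡ l ℤ.* u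
  A≡lu = begin
    A                                  ≡⟨ ℤP.*-identityʳ A ⟨
    A ℤ.* 1ℤ                           ≡⟨ cong (A ℤ.*_) su+tv≡1 ⟨
    A ℤ.* (s ℤ.* u ℤ.+ t ℤ.* v)        ≡⟨ solve (A ∷ s ∷ u ∷ t ∷ v ∷ []) ℤ-ring ⟩
    s ℤ.* A ℤ.* u ℤ.+ t ℤ.* (A ℤ.* v)  ≡⟨ cong (λ x → s ℤ.* A ℤ.* u ℤ.+ t ℤ.* x) Av≡uC ⟩
    s ℤ.* A ℤ.* u ℤ.+ t ℤ.* (u ℤ.* C)  ≡⟨ solve (A ∷ s ∷ u ∷ t ∷ C ∷ []) ℤ-ring ⟩
    (s ℤ.* A ℤ.+ t ℤ.* C) ℤ.* u        ∎
  C≡lv : C ≡ l ℤ.* v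
  C≡lv = begin
    C                                  ≡⟨ ℤP.*-identityʳ C ⟨
    C ℤ.* 1ℤ                           ≡⟨ cong (C ℤ.*_) su+tv≡1 ⟨
    C ℤ.* (s ℤ.* u ℤ.+ t ℤ.* v)        ≡⟨ solve (C ∷ s ∷ u ∷ t ∷ v ∷ []) ℤ-ring ⟩
    s ℤ.* (u ℤ.* C) ℤ.+ t ℤ.* C ℤ.* v  ≡⟨ cong (λ x → s ℤ.* x ℤ.+ t ℤ.* C ℤ.* v) Av≡uC ⟨
    s ℤ.* (A ℤ.* v) ℤ.+ t ℤ.* C ℤ.* v  ≡⟨ solve (A ∷ s ∷ v ∷ t ∷ C ∷ []) ℤ-ring ⟩
    (s ℤ.* A ℤ.+ t ℤ.* C) ℤ.* v        ∎

pos-+* : ∀ {a b c d e} → a ℕ.+ b ℕ.* c ≡ d ℕ.* e → + a ℤ.+ + b ℤ.* + c ≡ + d ℤ.* + e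
pos-+* {a} {b} {c} {d} {e} eq = begin
  + a ℤ.+ + b ℤ.* + c   ≡⟨ cong (λ w → + a ℤ.+ w) (ℤP.pos-* b c) ⟨
  + a ℤ.+ + (b ℕ.* c)   ≡⟨ ℤP.pos-+ a (b ℕ.* c) ⟨
  + (a ℕ.+ b ℕ.* c)     ≡⟨ cong +_ eq ⟩
  + (d ℕ.* e)           ≡⟨ ℤP.pos-* d e ⟩
  + d ℤ.* + e           ∎

bézout : ∀ m n → ∃₂ λ s t → s ℤ.* + m ℤ.+ t ℤ.* + n ≡ + ℕG.gcd m n
bézout m n with ℕG.Bézout.identity (ℕG.gcd-GCD m n)
... | ℕG.Bézout.+- x y eq = + x , ℤ.- + y , (begin
  + x ℤ.* + m ℤ.+ ℤ.- + y ℤ.* + n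
    ≡⟨ cong (λ w → w ℤ.+ ℤ.- + y ℤ.* + n) (pos-+* {ℕG.gcd m n} {y} {n} {x} {m} eq) ⟨
  + ℕG.gcd m n ℤ.+ + y ℤ.* + n ℤ.+ ℤ.- + y ℤ.* + n
    ≡⟨ cancel (+ ℕG.gcd m n) (+ y) (+ n) ⟩
  + ℕG.gcd m n ∎)
  where
  cancel : ∀ a b c → a ℤ.+ b ℤ.* c ℤ.+ ℤ.- b ℤ.* c ≡ a
  cancel = solve-∀ ℤ-ring
... | ℕG.Bézout.-+ x y eq = ℤ.- + x , + y , (begin
  ℤ.- + x ℤ.* + m ℤ.+ + y ℤ.* + n
    ≡⟨ cong (λ w → ℤ.- + x ℤ.* + m ℤ.+ w) (pos-+* {ℕG.gcd m n} {x} {m} {y} {n} eq) ⟨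
  ℤ.- + x ℤ.* + m ℤ.+ (+ ℕG.gcd m n ℤ.+ + x ℤ.* + m)
    ≡⟨ cancel (+ ℕG.gcd m n) (+ x) (+ m) ⟩
  + ℕG.gcd m n ∎)
  where
  cancel : ∀ a b c → ℤ.- b ℤ.* c ℤ.+ (a ℤ.+ b ℤ.* c) ≡ a
  cancel = solve-∀ ℤ-ring

gcd≡1⇒coprime : ∀ a d → ℕG.gcd ℤ.∣ a ∣ d ≡ 1 → Coprime a (+ d)
gcd≡1⇒coprime (+ n) d gcd≡1 with bézout n d
... | s , t , eq = s , t , trans eq (cong +_ gcd≡1)
gcd≡1⇒coprime -[1+ n ] d gcd≡1 = coprime-‿-ˡ (gcd≡1⇒coprime (+ suc n) d gcd≡1)

coprime⇒gcd≡1 : ∀ {a d} → Coprime a (+ d) → ℕG.gcd ℤ.∣ a ∣ d ≡ 1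
coprime⇒gcd≡1 {a} {d} (s , t , eq) = ℕC.coprime⇒gcd≡1 common-divisor≡1
  where
  common-divisor≡1 : ℕC.Coprime ℤ.∣ a ∣ d
  common-divisor≡1 {i} (i∣a , i∣d) = ℕD.∣1⇒≡1 (∣⇒∣ᵤ (subst (+ i ∣ᶻ_) eq
    (∣m∣n⇒∣m+n (∣n⇒∣m*n s (∣ᵤ⇒∣ {+ i} i∣a)) (∣n⇒∣m*n t (∣ᵤ⇒∣ {+ i} i∣d)))))

record GcdSplit (x : ℤ) (M : ℕ) : Set where
  field
    g M′ : ℕ
    x′ : ℤ
    x≡x′*g : x ≡ x′ ℤ.* + g
    M≡M′*g : M ≡ M′ ℕ.* g
    coprime : Coprime x′ (+ M′)

gcdSplit : ∀ x M → M ≢ 0 → GcdSplit x M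
gcdSplit (+ n) M M≢0 with bézout n M
... | s , t , eq = record
  { g = g ; M′ = q₂ ; x′ = + q₁
  ; x≡x′*g = trans (cong +_ n≡q₁g) (ℤP.pos-* q₁ g)
  ; M≡M′*g = M≡q₂g
  ; coprime = s , t , ℤP.*-cancelʳ-≡ _ 1ℤ (+ g) (begin
      (s ℤ.* + q₁ ℤ.+ t ℤ.* + q₂) ℤ.* + g    ≡⟨ distrib s t (+ q₁) (+ q₂) (+ g) ⟩
      s ℤ.* (+ q₁ ℤ.* + g) ℤ.+ t ℤ.* (+ q₂ ℤ.* + g)
        ≡⟨ cong₂ (λ a b → s ℤ.* a ℤ.+ t ℤ.* b) (sym (trans (cong +_ n≡q₁g) (ℤP.pos-* q₁ g)))
                                              (sym (trans (cong +_ M≡q₂g) (ℤP.pos-* q₂ g))) ⟩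
      s ℤ.* + n ℤ.+ t ℤ.* + M               ≡⟨ eq ⟩
      + g                                    ≡⟨ ℤP.*-identityˡ (+ g) ⟨
      1ℤ ℤ.* + g                             ∎)
  }
  where
  g : ℕ
  g = ℕG.gcd n M
  q₁ : ℕ
  q₁ = ℕD.quotient (ℕG.gcd[m,n]∣m n M)
  q₂ : ℕ
  q₂ = ℕD.quotient (ℕG.gcd[m,n]∣n n M)
  n≡q₁g : n ≡ q₁ ℕ.* g
  n≡q₁g = ℕD._∣_.equality (ℕG.gcd[m,n]∣m n M)
  M≡q₂g : M ≡ q₂ ℕ.* g
  M≡q₂g = ℕD._∣_.equality (ℕG.gcd[m,n]∣n n M)
  instance
    g-nonZero : ℤ.NonZero (+ g)
    g-nonZero = ℤ.≢-nonZero (λ g≡0 → ℕG.gcd[m,n]≢0 n M (inj₂ M≢0) (ℤP.+-injective g≡0))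
  distrib : ∀ s t a b c → (s ℤ.* a ℤ.+ t ℤ.* b) ℤ.* c ≡ s ℤ.* (a ℤ.* c) ℤ.+ t ℤ.* (b ℤ.* c)
  distrib = solve-∀ ℤ-ring
gcdSplit -[1+ n ] M M≢0 = record
  { GcdSplit split
  ; x′ = ℤ.- x′
  ; x≡x′*g = trans (cong ℤ.-_ x≡x′*g) (ℤP.neg-distribˡ-* x′ (+ g))
  ; coprime = coprime-‿-ˡ coprime
  }
  where
  split : GcdSplit (+ suc n) M
  split = gcdSplit (+ suc n) M M≢0
  open GcdSplit split

coprime-+*-divisor : ∀ {x y t g} → Coprime x y → g ∣ᶻ x → Coprime t x → Coprime (x ℤ.+ t ℤ.* y) g
coprime-+*-divisor {y = y} {t} {g} x⊥y g∣x@(divides x′ refl) t⊥x =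
  subst (λ w → Coprime w g) (ℤP.+-comm (t ℤ.* y) (x′ ℤ.* g)) (coprime-+* x′ ty⊥g)
  where
  ty⊥g : Coprime (t ℤ.* y) g
  ty⊥g = coprime-*ˡ (coprime-∣ʳ t⊥x g∣x) (coprime-∣ʳ (coprime-sym x⊥y) g∣x)

-- Induction on M: split off g = gcd(x, M), M = M′g.  A t that works for M′ and is a unit
-- modulo x also works for g, because x + t·y ≡ t·y (mod g).
coprime-translate : ∀ {x y} → Coprime x y → ∀ M → M ≢ 0 → ∃[ t ] Coprime (x ℤ.+ t ℤ.* y) (+ M)
coprime-translate {x} {y} x⊥y M M≢0 = map₂ proj₁ (go M (<-wellFounded M) M≢0)
  where
  go : ∀ M → Acc ℕ._<_ M → M ≢ 0 → ∃[ t ] Coprime (x ℤ.+ t ℤ.* y) (+ M) × Coprime t x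
  go M (acc rec) M≢0 = extend (gcdSplit x M M≢0)
    where
    extend : GcdSplit x M → ∃[ t ] Coprime (x ℤ.+ t ℤ.* y) (+ M) × Coprime t x
    extend record { g = 0 ; M′ = M′ ; M≡M′*g = M≡M′*0 } = ⊥-elim (M≢0 (trans M≡M′*0 (ℕP.*-zeroʳ M′)))
    extend record { g = 1 ; M′ = M′ ; x′ = x′ ; x≡x′*g = x≡x′*1 ; M≡M′*g = M≡M′*1 ; coprime = x′⊥M′ } =
      + M , subst (λ w → Coprime (x ℤ.+ w) (+ M)) (ℤP.*-comm y (+ M)) (coprime-+* y x⊥M) , coprime-sym x⊥M
      where
      x⊥M : Coprime x (+ M)
      x⊥M = subst₂ Coprime (sym (trans x≡x′*1 (ℤP.*-identityʳ x′)))
                           (cong +_ (sym (trans M≡M′*1 (ℕP.*-identityʳ M′)))) x′⊥M′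
    extend record { g = g@(suc (suc _)) ; M′ = M′ ; x′ = x′ ; x≡x′*g = x≡x′*g ; M≡M′*g = M≡M′*g } =
      let t , x+ty⊥M′ , t⊥x = go M′ (rec M′<M) M′≢0
      in t , subst (Coprime (x ℤ.+ t ℤ.* y)) M′g≡M
               (coprime-*ʳ x+ty⊥M′ (coprime-+*-divisor x⊥y (divides x′ x≡x′*g) t⊥x)) , t⊥x
      where
      M′≢0 : M′ ≢ 0
      M′≢0 refl = M≢0 M≡M′*g
      M′<M : M′ ℕ.< M
      M′<M = subst (M′ ℕ.<_) (sym M≡M′*g) (ℕP.m<m*n M′ g {{ℕ.≢-nonZero M′≢0}} (ℕ.s≤s (ℕ.s≤s ℕ.z≤n)))
      M′g≡M : + M′ ℤ.* + g ≡ + M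
      M′g≡M = trans (sym (ℤP.pos-* M′ g)) (cong +_ (sym M≡M′*g))

bézout-coprime-to : ∀ {x y} → Coprime x y → ∀ M → M ≢ 0 →
                    ∃₂ λ δ k → δ ℤ.* x ℤ.+ k ℤ.* y ≡ 1ℤ × Coprime δ (+ M)
bézout-coprime-to {x} {y} (s , t , sx+ty≡1) M M≢0 with coprime-translate s⊥y M M≢0
  where
  s⊥y : Coprime s y
  s⊥y = x , t , trans (cong (ℤ._+ t ℤ.* y) (ℤP.*-comm x s)) sx+ty≡1
... | T , δ⊥M = s ℤ.+ T ℤ.* y , t ℤ.- T ℤ.* x , trans (shift s t T x y) sx+ty≡1 , δ⊥M
  where
  shift : ∀ s t T x y → (s ℤ.+ T ℤ.* y) ℤ.* x ℤ.+ (t ℤ.- T ℤ.* x) ℤ.* y ≡ s ℤ.* x ℤ.+ t ℤ.* y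
  shift = solve-∀ ℤ-ring

IsInt-coprime : ∀ {m n h} → Coprime m n → IsInt (ι m ℚ.* h) → IsInt (ι n ℚ.* h) → IsInt h
IsInt-coprime {m} {n} {h} (s , t , sm+tn≡1) mh∈ℤ nh∈ℤ =
  subst IsInt combination (IsInt-+ (IsInt-* (s , refl) mh∈ℤ) (IsInt-* (t , refl) nh∈ℤ))
  where
  regroup : ∀ s m t n h → s ℚ.* (m ℚ.* h) ℚ.+ t ℚ.* (n ℚ.* h) ≡ (s ℚ.* m ℚ.+ t ℚ.* n) ℚ.* h
  regroup = solve-∀ ℚ-ring
  combination : ι s ℚ.* (ι m ℚ.* h) ℚ.+ ι t ℚ.* (ι n ℚ.* h) ≡ h
  combination = begin
    ι s ℚ.* (ι m ℚ.* h) ℚ.+ ι t ℚ.* (ι n ℚ.* h) ≡⟨ regroup (ι s) (ι m) (ι t) (ι n) h ⟩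
    (ι s ℚ.* ι m ℚ.+ ι t ℚ.* ι n) ℚ.* h         ≡⟨ cong (ℚ._* h) (cong₂ ℚ._+_ (ι-homo-* s m) (ι-homo-* t n)) ⟨
    (ι (s ℤ.* m) ℚ.+ ι (t ℤ.* n)) ℚ.* h         ≡⟨ cong (ℚ._* h) (ι-homo-+ (s ℤ.* m) (t ℤ.* n)) ⟨
    ι (s ℤ.* m ℤ.+ t ℤ.* n) ℚ.* h               ≡⟨ cong (λ x → ι x ℚ.* h) sm+tn≡1 ⟩
    1ℚ ℚ.* h                                    ≡⟨ ℚP.*-identityˡ h ⟩
    h                                           ∎

*-≢0 : ∀ {m n} → m ≢ 0 → n ≢ 0 → m ℕ.* n ≢ 0
*-≢0 {m} {n} m≢0 n≢0 = ℕ.≢-nonZero⁻¹ (m ℕ.* n) {{ℕP.m*n≢0 m n {{ℕ.≢-nonZero m≢0}} {{ℕ.≢-nonZero n≢0}}}}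


pt : ℤ → ℤ → Pt
pt u v = ι u , ι v

∼-refl : ∀ {x} → x ∼ x
∼-refl = refl

∼-sym : ∀ {x y} → x ∼ y → y ∼ x
∼-sym = sym

∼-trans : ∀ {x y z} → ValidPt y → x ∼ y → y ∼ z → x ∼ z
∼-trans {p , q} {p′ , q′} {p″ , q″} y-valid pq′≡p′q p′q″≡p″q′ with p′ ℚP.≟ 0ℚ
... | no p′≢0 = *-cancelˡ-≡ p′≢0 (begin
  p′ ℚ.* (p ℚ.* q″)  ≡⟨ solve (p′ ∷ p ∷ q″ ∷ []) ℚ-ring ⟩
  p ℚ.* (p′ ℚ.* q″)  ≡⟨ cong (p ℚ.*_) p′q″≡p″q′ ⟩
  p ℚ.* (p″ ℚ.* q′)  ≡⟨ solve (p ∷ p″ ∷ q′ ∷ []) ℚ-ring ⟩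
  p″ ℚ.* (p ℚ.* q′)  ≡⟨ cong (p″ ℚ.*_) pq′≡p′q ⟩
  p″ ℚ.* (p′ ℚ.* q)  ≡⟨ solve (p″ ∷ p′ ∷ q ∷ []) ℚ-ring ⟩
  p′ ℚ.* (p″ ℚ.* q)  ∎)
... | yes p′≡0 = *-cancelˡ-≡ (λ q′≡0 → y-valid (p′≡0 , q′≡0)) (begin
  q′ ℚ.* (p ℚ.* q″)  ≡⟨ solve (q′ ∷ p ∷ q″ ∷ []) ℚ-ring ⟩
  p ℚ.* q′ ℚ.* q″    ≡⟨ cong (ℚ._* q″) pq′≡p′q ⟩
  p′ ℚ.* q ℚ.* q″    ≡⟨ solve (p′ ∷ q ∷ q″ ∷ []) ℚ-ring ⟩
  q ℚ.* (p′ ℚ.* q″)  ≡⟨ cong (q ℚ.*_) p′q″≡p″q′ ⟩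
  q ℚ.* (p″ ℚ.* q′)  ≡⟨ solve (q ∷ p″ ∷ q′ ∷ []) ℚ-ring ⟩
  q′ ℚ.* (p″ ℚ.* q)  ∎)

act-resp-∼ : ∀ γ {x y} → x ∼ y → act γ x ∼ act γ y
act-resp-∼ (mat a b c d) {p , q} {p′ , q′} pq′≡p′q = begin
  (a ℚ.* p ℚ.+ b ℚ.* q) ℚ.* (c ℚ.* p′ ℚ.+ d ℚ.* q′)
    ≡⟨ solve (a ∷ b ∷ c ∷ d ∷ p ∷ q ∷ p′ ∷ q′ ∷ []) ℚ-ring ⟩
  (a ℚ.* p′ ℚ.+ b ℚ.* q′) ℚ.* (c ℚ.* p ℚ.+ d ℚ.* q)
    ℚ.+ (a ℚ.* d ℚ.- b ℚ.* c) ℚ.* (p ℚ.* q′ ℚ.- p′ ℚ.* q)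
    ≡⟨ cong (λ w → (a ℚ.* p′ ℚ.+ b ℚ.* q′) ℚ.* (c ℚ.* p ℚ.+ d ℚ.* q)
                   ℚ.+ (a ℚ.* d ℚ.- b ℚ.* c) ℚ.* (w ℚ.- p′ ℚ.* q)) pq′≡p′q ⟩
  (a ℚ.* p′ ℚ.+ b ℚ.* q′) ℚ.* (c ℚ.* p ℚ.+ d ℚ.* q)
    ℚ.+ (a ℚ.* d ℚ.- b ℚ.* c) ℚ.* (p′ ℚ.* q ℚ.- p′ ℚ.* q)
    ≡⟨ solve (a ∷ b ∷ c ∷ d ∷ p ∷ q ∷ p′ ∷ q′ ∷ []) ℚ-ring ⟩
  (a ℚ.* p′ ℚ.+ b ℚ.* q′) ℚ.* (c ℚ.* p ℚ.+ d ℚ.* q) ∎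

act-adj : ∀ γ x → det γ ≡ 1ℚ → act (adj γ) (act γ x) ≡ x
act-adj (mat a b c d) (p , q) det≡1 = cong₂ _,_
  (begin
    d ℚ.* (a ℚ.* p ℚ.+ b ℚ.* q) ℚ.+ ℚ.- b ℚ.* (c ℚ.* p ℚ.+ d ℚ.* q) ≡⟨ solve (a ∷ b ∷ c ∷ d ∷ p ∷ q ∷ []) ℚ-ring ⟩
    (a ℚ.* d ℚ.+ ℚ.- (b ℚ.* c)) ℚ.* p                              ≡⟨ cong (ℚ._* p) det≡1 ⟩
    1ℚ ℚ.* p                                                       ≡⟨ ℚP.*-identityˡ p ⟩
    p                                                              ∎)
  (begin
    ℚ.- c ℚ.* (a ℚ.* p ℚ.+ b ℚ.* q) ℚ.+ a ℚ.* (c ℚ.* p ℚ.+ d ℚ.* q) ≡⟨ solve (a ∷ b ∷ c ∷ d ∷ p ∷ q ∷ []) ℚ-ring ⟩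
    (a ℚ.* d ℚ.+ ℚ.- (b ℚ.* c)) ℚ.* q                              ≡⟨ cong (ℚ._* q) det≡1 ⟩
    1ℚ ℚ.* q                                                       ≡⟨ ℚP.*-identityˡ q ⟩
    q                                                              ∎)

act-∞ : ∀ a b c d → act (mat a b c d) ∞pt ≡ (a , c)
act-∞ a b c d = cong₂ _,_ (first-column a b) (first-column c d)
  where
  first-column : ∀ x y → x ℚ.* 1ℚ ℚ.+ y ℚ.* 0ℚ ≡ x
  first-column = solve-∀ ℚ-ring

coprime⇒valid : ∀ {u v} → Coprime u v → ValidPt (pt u v)
coprime⇒valid {u} {v} (s , t , eq) (u≡0 , v≡0) with ι-injective {u} {0ℤ} u≡0 | ι-injective {v} {0ℤ} v≡0
... | refl | refl = 1≢0 (trans (sym eq) (cong₂ ℤ._+_ (ℤP.*-zeroʳ s) (ℤP.*-zeroʳ t)))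
  where
  1≢0 : 1ℤ ≢ 0ℤ
  1≢0 ()

∼-scale : ∀ {y p q} m → y ∼ pt p q → y ∼ pt (m ℤ.* p) (m ℤ.* q)
∼-scale {y₁ , y₂} {p} {q} m y∼pq = begin
  y₁ ℚ.* ι (m ℤ.* q)      ≡⟨ cong (y₁ ℚ.*_) (ι-homo-* m q) ⟩
  y₁ ℚ.* (ι m ℚ.* ι q)    ≡⟨ x∙yz≈y∙xz y₁ (ι m) (ι q) ⟩
  ι m ℚ.* (y₁ ℚ.* ι q)    ≡⟨ cong (ι m ℚ.*_) y∼pq ⟩
  ι m ℚ.* (ι p ℚ.* y₂)    ≡⟨ ℚP.*-assoc (ι m) (ι p) y₂ ⟨
  ι m ℚ.* ι p ℚ.* y₂      ≡⟨ cong (ℚ._* y₂) (ι-homo-* m p) ⟨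
  ι (m ℤ.* p) ℚ.* y₂      ∎

∼-unscale : ∀ {y p q} m → m ≢ 0ℤ → y ∼ pt (m ℤ.* p) (m ℤ.* q) → y ∼ pt p q
∼-unscale {y₁ , y₂} {p} {q} m m≢0 y∼mpq = *-cancelˡ-≡ (λ ιm≡0 → m≢0 (ι-injective ιm≡0)) (begin
  ι m ℚ.* (y₁ ℚ.* ι q)   ≡⟨ x∙yz≈y∙xz (ι m) y₁ (ι q) ⟩
  y₁ ℚ.* (ι m ℚ.* ι q)   ≡⟨ cong (y₁ ℚ.*_) (ι-homo-* m q) ⟨
  y₁ ℚ.* ι (m ℤ.* q)     ≡⟨ y∼mpq ⟩
  ι (m ℤ.* p) ℚ.* y₂     ≡⟨ cong (ℚ._* y₂) (ι-homo-* m p) ⟩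
  ι m ℚ.* ι p ℚ.* y₂     ≡⟨ ℚP.*-assoc (ι m) (ι p) y₂ ⟩
  ι m ℚ.* (ι p ℚ.* y₂)   ∎)

divN-pt : ∀ N u v → divN N (pt u v) ≡ pt u (+ N ℤ.* v)
divN-pt N u v = cong (ι u ,_) (sym (ι-homo-* (+ N) v))

divN-resp-∼ : ∀ N {x x′} → x ∼ x′ → divN N x ∼ divN N x′
divN-resp-∼ N {p , q} {p′ , q′} pq′≡p′q = begin
  p ℚ.* (ℕ→ℚ N ℚ.* q′)   ≡⟨ x∙yz≈y∙xz p (ℕ→ℚ N) q′ ⟩
  ℕ→ℚ N ℚ.* (p ℚ.* q′)   ≡⟨ cong (ℕ→ℚ N ℚ.*_) pq′≡p′q ⟩
  ℕ→ℚ N ℚ.* (p′ ℚ.* q)   ≡⟨ x∙yz≈y∙xz (ℕ→ℚ N) p′ q ⟩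
  p′ ℚ.* (ℕ→ℚ N ℚ.* q)   ∎

divN-valid : ∀ N {x} → N ≢ 0 → ValidPt x → ValidPt (divN N x)
divN-valid N {p , q} N≢0 x-valid (p≡0 , Nq≡0) =
  x-valid (p≡0 , *-cancelˡ-≡ N≢0′ (trans Nq≡0 (sym (ℚP.*-zeroʳ (ℕ→ℚ N)))))
  where
  N≢0′ : ℕ→ℚ N ≢ 0ℚ
  N≢0′ ιN≡0 = N≢0 (ℤP.+-injective (ι-injective ιN≡0))

∼-divN : ∀ {N x y u v} → N ≢ 0 → ValidPt x → y ∼ divN N x → x ∼ pt u v → y ∼ pt u (+ N ℤ.* v)
∼-divN {N} {x} {y} {u} {v} N≢0 x-valid y∼x/N x∼uv =
  ∼-trans {y} {divN N x} {pt u (+ N ℤ.* v)} (divN-valid N N≢0 x-valid) y∼x/N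
    (subst (divN N x ∼_) (divN-pt N u v) (divN-resp-∼ N {x} {pt u v} x∼uv))


matℤ : ℤ → ℤ → ℤ → ℤ → M2
matℤ A B C D = mat (ι A) (ι B) (ι C) (ι D)

det-matℤ : ∀ A B C D → det (matℤ A B C D) ≡ ι (A ℤ.* D ℤ.- B ℤ.* C)
det-matℤ A B C D = sym (begin
  ι (A ℤ.* D ℤ.- B ℤ.* C)                   ≡⟨ ι-homo-+ (A ℤ.* D) (ℤ.- (B ℤ.* C)) ⟩
  ι (A ℤ.* D) ℚ.+ ι (ℤ.- (B ℤ.* C))         ≡⟨ cong (ι (A ℤ.* D) ℚ.+_) (ι-homo‿- (B ℤ.* C)) ⟩
  ι (A ℤ.* D) ℚ.- ι (B ℤ.* C)               ≡⟨ cong₂ ℚ._-_ (ι-homo-* A D) (ι-homo-* B C) ⟩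
  ι A ℚ.* ι D ℚ.- ι B ℚ.* ι C               ∎)

act-matℤ : ∀ A B C D u v → act (matℤ A B C D) (pt u v) ≡ pt (A ℤ.* u ℤ.+ B ℤ.* v) (C ℤ.* u ℤ.+ D ℤ.* v)
act-matℤ A B C D u v = sym (cong₂ _,_ (linear A B) (linear C D))
  where
  linear : ∀ P Q → ι (P ℤ.* u ℤ.+ Q ℤ.* v) ≡ ι P ℚ.* ι u ℚ.+ ι Q ℚ.* ι v
  linear P Q = trans (ι-homo-+ (P ℤ.* u) (Q ℤ.* v)) (cong₂ ℚ._+_ (ι-homo-* P u) (ι-homo-* Q v))

adj-matℤ : ∀ A B C D → adj (matℤ A B C D) ≡ matℤ D (ℤ.- B) (ℤ.- C) A
adj-matℤ A B C D = cong₂ (λ b c → mat (ι D) b c (ι A)) (sym (ι-homo‿- B)) (sym (ι-homo‿- C))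

det-adj : ∀ A B C D → D ℤ.* A ℤ.- ℤ.- B ℤ.* ℤ.- C ≡ A ℤ.* D ℤ.- B ℤ.* C
det-adj = solve-∀ ℤ-ring

coprime-act : ∀ A B C D {u v} → A ℤ.* D ℤ.- B ℤ.* C ≡ 1ℤ → Coprime u v →
              Coprime (A ℤ.* u ℤ.+ B ℤ.* v) (C ℤ.* u ℤ.+ D ℤ.* v)
coprime-act A B C D {u} {v} det≡1 (s , t , eq) = s ℤ.* D ℤ.- t ℤ.* C , t ℤ.* A ℤ.- s ℤ.* B , (begin
  (s ℤ.* D ℤ.- t ℤ.* C) ℤ.* (A ℤ.* u ℤ.+ B ℤ.* v) ℤ.+ (t ℤ.* A ℤ.- s ℤ.* B) ℤ.* (C ℤ.* u ℤ.+ D ℤ.* v)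
    ≡⟨ solve (A ∷ B ∷ C ∷ D ∷ u ∷ v ∷ s ∷ t ∷ []) ℤ-ring ⟩
  (A ℤ.* D ℤ.- B ℤ.* C) ℤ.* (s ℤ.* u ℤ.+ t ℤ.* v)
    ≡⟨ cong₂ ℤ._*_ det≡1 eq ⟩
  1ℤ ∎)

record Γ₀ℤ (M : ℕ) : Set where
  field
    A B C D k : ℤ
    det≡1 : A ℤ.* D ℤ.- B ℤ.* C ≡ 1ℤ
    C≡kM : C ≡ k ℤ.* + M

  matrix : M2
  matrix = matℤ A B C D

  adj-det≡1 : D ℤ.* A ℤ.- ℤ.- B ℤ.* ℤ.- C ≡ 1ℤ
  adj-det≡1 = trans (det-adj A B C D) det≡1

Γ₀ℤ-sound : ∀ {M} (γ : Γ₀ℤ M) → Γ₀ M (Γ₀ℤ.matrix γ)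
Γ₀ℤ-sound record { A = A ; B = B ; C = C ; D = D ; k = k ; det≡1 = det≡1 ; C≡kM = C≡kM } =
  ((A , refl) , (B , refl) , (C , refl) , (D , refl) , trans (det-matℤ A B C D) (cong ι det≡1)) ,
  (k , cong ι C≡kM)

Γ₀ℤ-complete : ∀ {M m} → Γ₀ M m → Σ (Γ₀ℤ M) λ γ → m ≡ Γ₀ℤ.matrix γ
Γ₀ℤ-complete {M} {mat _ _ _ _} (((A , refl) , (B , refl) , (C , refl) , (D , refl) , det≡1) , (k , C≡kM)) =
  record { A = A ; B = B ; C = C ; D = D ; k = k
         ; det≡1 = ι-injective (trans (sym (det-matℤ A B C D)) det≡1)
         ; C≡kM = ι-injective C≡kM } ,
  refl

SL2Z-elim : ∀ {m} → SL2Z m → ∃₂ λ A B → ∃₂ λ C D → m ≡ matℤ A B C D × A ℤ.* D ℤ.- B ℤ.* C ≡ 1ℤ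
SL2Z-elim {mat _ _ _ _} ((A , refl) , (B , refl) , (C , refl) , (D , refl) , det≡1) =
  A , B , C , D , refl , ι-injective (trans (sym (det-matℤ A B C D)) det≡1)

Γ₀-mono : ∀ {M L} → M ∣ L → Γ₀ L ⊆ Γ₀ M
Γ₀-mono {M} (ℕD.divides q refl) (m∈SL , k , c≡kL) =
  m∈SL , k ℤ.* + q , trans c≡kL (cong ι (trans (cong (k ℤ.*_) (ℤP.pos-* q M)) (sym (ℤP.*-assoc k (+ q) (+ M)))))

Equiv-mono : ∀ {G H : Grp} {x y} → G ⊆ H → Equiv G x y → Equiv H x y
Equiv-mono G⊆H (γ , γ∈G , γx∼y) = γ , G⊆H γ∈G , γx∼y

mat-cong : ∀ {a a′ b b′ c c′ d d′} → a ≡ a′ → b ≡ b′ → c ≡ c′ → d ≡ d′ → mat a b c d ≡ mat a′ b′ c′ d′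
mat-cong refl refl refl refl = refl

neg-involutive : ∀ m → neg (neg m) ≡ m
neg-involutive (mat a b c d) =
  mat-cong (ℚ-neg-involutive a) (ℚ-neg-involutive b) (ℚ-neg-involutive c) (ℚ-neg-involutive d)

⊗-negʳ : ∀ X m → X ⊗ neg m ≡ neg (X ⊗ m)
⊗-negʳ (mat a b c d) (mat p q r s) = mat-cong (entry a p b r) (entry a q b s) (entry c p d r) (entry c q d s)
  where
  entry : ∀ a p b r → a ℚ.* ℚ.- p ℚ.+ b ℚ.* ℚ.- r ≡ ℚ.- (a ℚ.* p ℚ.+ b ℚ.* r)
  entry = solve-∀ ℚ-ring

⊗-negˡ : ∀ X m → neg X ⊗ m ≡ neg (X ⊗ m)
⊗-negˡ (mat a b c d) (mat p q r s) = mat-cong (entry a p b r) (entry a q b s) (entry c p d r) (entry c q d s)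
  where
  entry : ∀ a p b r → ℚ.- a ℚ.* p ℚ.+ ℚ.- b ℚ.* r ≡ ℚ.- (a ℚ.* p ℚ.+ b ℚ.* r)
  entry = solve-∀ ℚ-ring

NegClosed : Grp → Set
NegClosed G = ∀ m → G (neg m) → G m

neg-closed : ∀ {G : Grp} → (∀ {m} → G m → G (neg m)) → NegClosed G
neg-closed {G} G-neg m neg-m∈G = subst G (neg-involutive m) (G-neg neg-m∈G)

Γ₀-neg : ∀ {M m} → Γ₀ M m → Γ₀ M (neg m)
Γ₀-neg {M} m∈Γ₀ with Γ₀ℤ-complete m∈Γ₀
... | record { A = A ; B = B ; C = C ; D = D ; k = k ; det≡1 = det≡1 ; C≡kM = C≡kM } , refl =
  subst (Γ₀ M) (mat-cong (ι-homo‿- A) (ι-homo‿- B) (ι-homo‿- C) (ι-homo‿- D)) (Γ₀ℤ-sound γ)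
  where
  negated-det : ∀ A B C D → ℤ.- A ℤ.* ℤ.- D ℤ.- ℤ.- B ℤ.* ℤ.- C ≡ A ℤ.* D ℤ.- B ℤ.* C
  negated-det = solve-∀ ℤ-ring
  γ : Γ₀ℤ M
  γ = record { A = ℤ.- A ; B = ℤ.- B ; C = ℤ.- C ; D = ℤ.- D ; k = ℤ.- k
             ; det≡1 = trans (negated-det A B C D) det≡1
             ; C≡kM = trans (cong ℤ.-_ C≡kM) (ℤP.neg-distribˡ-* k (+ M)) }

Γ₀-negClosed : ∀ {M} → NegClosed (Γ₀ M)
Γ₀-negClosed = neg-closed Γ₀-neg

αN-⊗ : ∀ N a b c d → αN N ⊗ mat a b c d ≡ mat (ℕ→ℚ N ℚ.* a) (ℕ→ℚ N ℚ.* b) c d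
αN-⊗ N a b c d = mat-cong (drop (ℕ→ℚ N ℚ.* a) c) (drop (ℕ→ℚ N ℚ.* b) d) (keep a c) (keep b d)
  where
  drop : ∀ x y → x ℚ.+ 0ℚ ℚ.* y ≡ x
  drop = solve-∀ ℚ-ring
  keep : ∀ x y → 0ℚ ℚ.* x ℚ.+ 1ℚ ℚ.* y ≡ y
  keep = solve-∀ ℚ-ring

⊗-αN : ∀ N a b c d → mat a b c d ⊗ αN N ≡ mat (a ℚ.* ℕ→ℚ N) b (c ℚ.* ℕ→ℚ N) d
⊗-αN N a b c d = mat-cong (drop (a ℚ.* ℕ→ℚ N) b) (keep a b) (drop (c ℚ.* ℕ→ℚ N) d) (keep c d)
  where
  drop : ∀ x y → x ℚ.+ y ℚ.* 0ℚ ≡ x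
  drop = solve-∀ ℚ-ring
  keep : ∀ x y → x ℚ.* 0ℚ ℚ.+ y ℚ.* 1ℚ ≡ y
  keep = solve-∀ ℚ-ring

ι[k*N*N] : ∀ k N → ι (k ℤ.* + (N ℕ.* N)) ≡ ι (k ℤ.* + N) ℚ.* ℕ→ℚ N
ι[k*N*N] k N = begin
  ι (k ℤ.* + (N ℕ.* N))       ≡⟨ cong (λ x → ι (k ℤ.* x)) (ℤP.pos-* N N) ⟩
  ι (k ℤ.* (+ N ℤ.* + N))     ≡⟨ cong ι (ℤP.*-assoc k (+ N) (+ N)) ⟨
  ι (k ℤ.* + N ℤ.* + N)       ≡⟨ ι-homo-* (k ℤ.* + N) (+ N) ⟩
  ι (k ℤ.* + N) ℚ.* ℕ→ℚ N     ∎

Γ₀′-intro : ∀ {N} m A B k D → a m ≡ ι A → ℕ→ℚ N ℚ.* b m ≡ ι B → c m ≡ ι (k ℤ.* + (N ℕ.* N)) →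
            d m ≡ ι D → det m ≡ 1ℚ → Γ₀' N m
Γ₀′-intro {N} (mat _ b _ _) A B k D refl Nb≡B refl refl det≡1 = matℤ A B (k ℤ.* + N) D , Γ₀ℤ-sound γ , (begin
  αN N ⊗ mat (ι A) b (ι (k ℤ.* + (N ℕ.* N))) (ι D)
    ≡⟨ αN-⊗ N (ι A) b (ι (k ℤ.* + (N ℕ.* N))) (ι D) ⟩
  mat (ℕ→ℚ N ℚ.* ι A) (ℕ→ℚ N ℚ.* b) (ι (k ℤ.* + (N ℕ.* N))) (ι D)
    ≡⟨ mat-cong (ℚP.*-comm (ℕ→ℚ N) (ι A)) Nb≡B (ι[k*N*N] k N) refl ⟩
  mat (ι A ℚ.* ℕ→ℚ N) (ι B) (ι (k ℤ.* + N) ℚ.* ℕ→ℚ N) (ι D)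
    ≡⟨ ⊗-αN N (ι A) (ι B) (ι (k ℤ.* + N)) (ι D) ⟨
  matℤ A B (k ℤ.* + N) D ⊗ αN N ∎)
  where
  regroup : ∀ a d n b x → a ℚ.* d ℚ.- n ℚ.* b ℚ.* x ≡ a ℚ.* d ℚ.- b ℚ.* (x ℚ.* n)
  regroup = solve-∀ ℚ-ring
  γ : Γ₀ℤ N
  γ = record
    { A = A ; B = B ; C = k ℤ.* + N ; D = D ; k = k ; C≡kM = refl
    ; det≡1 = ι-injective (begin
        ι (A ℤ.* D ℤ.- B ℤ.* (k ℤ.* + N))
          ≡⟨ det-matℤ A B (k ℤ.* + N) D ⟨
        ι A ℚ.* ι D ℚ.- ι B ℚ.* ι (k ℤ.* + N)
          ≡⟨ cong (λ x → ι A ℚ.* ι D ℚ.- x ℚ.* ι (k ℤ.* + N)) Nb≡B ⟨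
        ι A ℚ.* ι D ℚ.- ℕ→ℚ N ℚ.* b ℚ.* ι (k ℤ.* + N)
          ≡⟨ regroup (ι A) (ι D) (ℕ→ℚ N) b (ι (k ℤ.* + N)) ⟩
        ι A ℚ.* ι D ℚ.- b ℚ.* (ι (k ℤ.* + N) ℚ.* ℕ→ℚ N)
          ≡⟨ cong (λ x → ι A ℚ.* ι D ℚ.- b ℚ.* x) (ι[k*N*N] k N) ⟨
        det (mat (ι A) b (ι (k ℤ.* + (N ℕ.* N))) (ι D))
          ≡⟨ det≡1 ⟩
        1ℚ ∎) }

Γ₀′-elim : ∀ {N m} → Γ₀' N m → IsInt (ℕ→ℚ N ℚ.* b m) × ∃[ k ] c m ≡ ι (k ℤ.* + (N ℕ.* N))
Γ₀′-elim {N} {mat a b c d} (γ , γ∈Γ₀ , αm≡γα) with Γ₀ℤ-complete γ∈Γ₀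
... | record { A = A ; B = B ; C = C ; D = D ; k = k ; C≡kM = refl } , refl =
  (B , cong M2.b sides) , k , trans (cong M2.c sides) (sym (ι[k*N*N] k N))
  where
  sides : mat (ℕ→ℚ N ℚ.* a) (ℕ→ℚ N ℚ.* b) c d ≡ mat (ι A ℚ.* ℕ→ℚ N) (ι B) (ι C ℚ.* ℕ→ℚ N) (ι D)
  sides = trans (sym (αN-⊗ N a b c d)) (trans αm≡γα (⊗-αN N (ι A) (ι B) (ι C) (ι D)))

Γ₀′-neg : ∀ {N m} → Γ₀' N m → Γ₀' N (neg m)
Γ₀′-neg {N} {m} (γ , γ∈Γ₀ , αm≡γα) = neg γ , Γ₀-neg γ∈Γ₀ , (begin
  αN N ⊗ neg m     ≡⟨ ⊗-negʳ (αN N) m ⟩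
  neg (αN N ⊗ m)   ≡⟨ cong neg αm≡γα ⟩
  neg (γ ⊗ αN N)   ≡⟨ ⊗-negˡ γ (αN N) ⟨
  neg γ ⊗ αN N     ∎)

Γ₀′-negClosed : ∀ {N} → NegClosed (Γ₀' N)
Γ₀′-negClosed {N} = neg-closed {Γ₀' N} (λ {m} → Γ₀′-neg {N} {m})

Γ₀²⊆Γ₀′ : ∀ {N} → Γ₀ (N ℕ.* N) ⊆ Γ₀' N
Γ₀²⊆Γ₀′ {N} m∈Γ₀ with Γ₀ℤ-complete m∈Γ₀
... | record { A = A ; B = B ; D = D ; k = k ; det≡1 = det≡1 ; C≡kM = refl } , refl =
  Γ₀′-intro _ A (+ N ℤ.* B) k D refl (sym (ι-homo-* (+ N) B)) refl refl (trans (det-matℤ A B _ D) (cong ι det≡1))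


InCusp-elim : ∀ {M a d y} → InCusp M a d y →
  Σ (Γ₀ℤ M) λ γ → let open Γ₀ℤ γ in y ∼ pt (D ℤ.* a ℤ.+ ℤ.- B ℤ.* + d) (ℤ.- C ℤ.* a ℤ.+ A ℤ.* + d)
InCusp-elim {M} {a} {d} {y} (m , m∈Γ₀ , my∼a/d) with Γ₀ℤ-complete m∈Γ₀
... | γ , refl = γ , subst₂ _∼_ (act-adj matrix y (trans (det-matℤ A B C D) (cong ι det≡1))) adj[a/d]
                                (act-resp-∼ (adj matrix) my∼a/d)
  where
  open Γ₀ℤ γ
  adj[a/d] : act (adj matrix) (pt a (+ d)) ≡ pt (D ℤ.* a ℤ.+ ℤ.- B ℤ.* + d) (ℤ.- C ℤ.* a ℤ.+ A ℤ.* + d)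
  adj[a/d] = trans (cong (λ n → act n (pt a (+ d))) (adj-matℤ A B C D)) (act-matℤ D (ℤ.- B) (ℤ.- C) A a (+ d))

InCusp-intro : ∀ {M a d y u v} (γ : Γ₀ℤ M) → let open Γ₀ℤ γ in
  y ∼ pt u v → A ℤ.* u ℤ.+ B ℤ.* v ≡ a → C ℤ.* u ℤ.+ D ℤ.* v ≡ + d → InCusp M a d y
InCusp-intro {y = y} {u} {v} γ y∼u/v top bottom =
  matrix , Γ₀ℤ-sound γ ,
  subst (act matrix y ∼_) (trans (act-matℤ A B C D u v) (cong₂ pt top bottom)) (act-resp-∼ matrix y∼u/v)
  where open Γ₀ℤ γ

record Representative (M d : ℕ) (y : Pt) : Set where
  field
    u v α j : ℤ
    y∼u/v : y ∼ pt u v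
    u⊥v : Coprime u v
    α⊥M : Coprime α (+ M)
    v≡αd+jM : v ≡ α ℤ.* + d ℤ.+ j ℤ.* + M

InCusp⇒representative : ∀ {M a d y} → InCusp M a d y → Coprime a (+ d) → Representative M d y
InCusp⇒representative {M} {a} {d} y∈[a/d] a⊥d with InCusp-elim y∈[a/d]
... | γ , y∼u/v = record
  { u = D ℤ.* a ℤ.+ ℤ.- B ℤ.* + d ; v = ℤ.- C ℤ.* a ℤ.+ A ℤ.* + d ; α = A ; j = ℤ.- (k ℤ.* a)
  ; y∼u/v = y∼u/v
  ; u⊥v = coprime-act D (ℤ.- B) (ℤ.- C) A adj-det≡1 a⊥d
  ; α⊥M = D , ℤ.- (B ℤ.* k) , (begin
      D ℤ.* A ℤ.+ ℤ.- (B ℤ.* k) ℤ.* + M  ≡⟨ α-combination D A B k (+ M) ⟩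
      A ℤ.* D ℤ.- B ℤ.* (k ℤ.* + M)      ≡⟨ cong (λ c → A ℤ.* D ℤ.- B ℤ.* c) C≡kM ⟨
      A ℤ.* D ℤ.- B ℤ.* C                ≡⟨ det≡1 ⟩
      1ℤ                                 ∎)
  ; v≡αd+jM = trans (cong (λ c → ℤ.- c ℤ.* a ℤ.+ A ℤ.* + d) C≡kM) (v-combination k (+ M) a A (+ d))
  }
  where
  open Γ₀ℤ γ
  α-combination : ∀ D A B k m → D ℤ.* A ℤ.+ ℤ.- (B ℤ.* k) ℤ.* m ≡ A ℤ.* D ℤ.- B ℤ.* (k ℤ.* m)
  α-combination = solve-∀ ℤ-ring
  v-combination : ∀ k m a A d → ℤ.- (k ℤ.* m) ℤ.* a ℤ.+ A ℤ.* d ≡ A ℤ.* d ℤ.+ ℤ.- (k ℤ.* a) ℤ.* m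
  v-combination = solve-∀ ℤ-ring

InCusp-0⇒ : ∀ {M y} → InCusp M (+ 1) 1 y → ∃₂ λ u v → y ∼ pt u v × Coprime u v × Coprime v (+ M)
InCusp-0⇒ {M} y∈[1/1] = u , v , y∼u/v , u⊥v ,
  subst (λ w → Coprime w (+ M)) (trans (cong (ℤ._+ j ℤ.* + M) (sym (ℤP.*-identityʳ α))) (sym v≡αd+jM))
        (coprime-+* j α⊥M)
  where open Representative (InCusp⇒representative y∈[1/1] (coprime-1ˡ (+ 1)))

InCusp-∞⇒ : ∀ {M y} → InCusp M (+ 1) M y → ∃₂ λ u v → y ∼ pt u v × Coprime u v × + M ∣ᶻ v
InCusp-∞⇒ {M} y∈[1/M] = u , v , y∼u/v , u⊥v ,
  divides (α ℤ.+ j) (trans v≡αd+jM (sym (ℤP.*-distribʳ-+ (+ M) α j)))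
  where open Representative (InCusp⇒representative y∈[1/M] (coprime-1ˡ (+ M)))

InCusp-0 : ∀ {M y u v} → y ∼ pt u v → Coprime u v → Coprime v (+ M) → InCusp M (+ 1) 1 y
InCusp-0 {M} {y} {u} {v} y∼u/v u⊥v v⊥M with coprime-*ʳ v⊥M (coprime-sym u⊥v)
... | s , t , sv+tMu≡1 =
  InCusp-intro γ y∼u/v (trans (top t (+ M) v s u) sv+tMu≡1) (trans (bottom t (+ M) v s u) sv+tMu≡1)
  where
  top : ∀ t m v s u → (t ℤ.* m ℤ.+ v) ℤ.* u ℤ.+ (s ℤ.- u) ℤ.* v ≡ s ℤ.* v ℤ.+ t ℤ.* (m ℤ.* u)
  top = solve-∀ ℤ-ring
  bottom : ∀ t m v s u → t ℤ.* m ℤ.* u ℤ.+ s ℤ.* v ≡ s ℤ.* v ℤ.+ t ℤ.* (m ℤ.* u)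
  bottom = solve-∀ ℤ-ring
  determinant : ∀ t m v s u → (t ℤ.* m ℤ.+ v) ℤ.* s ℤ.- (s ℤ.- u) ℤ.* (t ℤ.* m) ≡ s ℤ.* v ℤ.+ t ℤ.* (m ℤ.* u)
  determinant = solve-∀ ℤ-ring
  γ : Γ₀ℤ M
  γ = record { A = t ℤ.* + M ℤ.+ v ; B = s ℤ.- u ; C = t ℤ.* + M ; D = s ; k = t
             ; det≡1 = trans (determinant t (+ M) v s u) sv+tMu≡1 ; C≡kM = refl }

InCusp-∞ : ∀ {M y u v} → y ∼ pt u v → Coprime u v → + M ∣ᶻ v → InCusp M (+ 1) M y
InCusp-∞ {M} {y} {u} {v} y∼u/v (s , t , su+tv≡1) (divides w v≡wM) =
  InCusp-intro γ y∼u/v su+tv≡1 (trans (bottom (+ M) s t u v) (trans (cong (+ M ℤ.*_) su+tv≡1) (ℤP.*-identityʳ (+ M))))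
  where
  bottom : ∀ m s t u v → (m ℤ.* s ℤ.- v) ℤ.* u ℤ.+ (m ℤ.* t ℤ.+ u) ℤ.* v ≡ m ℤ.* (s ℤ.* u ℤ.+ t ℤ.* v)
  bottom = solve-∀ ℤ-ring
  determinant : ∀ m s t u v → s ℤ.* (m ℤ.* t ℤ.+ u) ℤ.- t ℤ.* (m ℤ.* s ℤ.- v) ≡ s ℤ.* u ℤ.+ t ℤ.* v
  determinant = solve-∀ ℤ-ring
  lower-left : ∀ m s w → m ℤ.* s ℤ.- w ℤ.* m ≡ (s ℤ.- w) ℤ.* m
  lower-left = solve-∀ ℤ-ring
  γ : Γ₀ℤ M
  γ = record { A = s ; B = t ; C = + M ℤ.* s ℤ.- v ; D = + M ℤ.* t ℤ.+ u ; k = s ℤ.- w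
             ; det≡1 = trans (determinant (+ M) s t u v) su+tv≡1
             ; C≡kM = trans (cong (λ x → + M ℤ.* s ℤ.- x) v≡wM) (lower-left (+ M) s w) }

-- δ is taken to be a unit modulo M so that (kM, δ) is a primitive row.
bottom-row : ∀ {M M′ d u v v′} → M ≢ 0 → Coprime u v → v ≡ v′ ℤ.* + d → M ≡ M′ ℕ.* d →
             Coprime v′ (+ M′) → ∃₂ λ k δ → Coprime δ (k ℤ.* + M) × k ℤ.* + M ℤ.* u ℤ.+ δ ℤ.* v ≡ + d
bottom-row {M} {M′} {d} {u} {v} {v′} M≢0 u⊥v v≡v′d M≡M′d v′⊥M′ =
  extend (bézout-coprime-to (coprime-*ʳ v′⊥M′ v′⊥u) M M≢0)
  where
  v′⊥u : Coprime v′ u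
  v′⊥u = coprime-∣ˡ (coprime-sym u⊥v) (divides (+ d) (trans v≡v′d (ℤP.*-comm v′ (+ d))))
  regroup : ∀ k m d u δ v → k ℤ.* (m ℤ.* d) ℤ.* u ℤ.+ δ ℤ.* (v ℤ.* d) ≡ (δ ℤ.* v ℤ.+ k ℤ.* (m ℤ.* u)) ℤ.* d
  regroup = solve-∀ ℤ-ring
  extend : (∃₂ λ δ k → δ ℤ.* v′ ℤ.+ k ℤ.* (+ M′ ℤ.* u) ≡ 1ℤ × Coprime δ (+ M)) →
           ∃₂ λ k δ → Coprime δ (k ℤ.* + M) × k ℤ.* + M ℤ.* u ℤ.+ δ ℤ.* v ≡ + d
  extend (δ , k , δv′+kM′u≡1 , δ⊥M) = k , δ , coprime-*ʳ δ⊥k δ⊥M , (begin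
    k ℤ.* + M ℤ.* u ℤ.+ δ ℤ.* v
      ≡⟨ cong₂ (λ m w → k ℤ.* m ℤ.* u ℤ.+ δ ℤ.* w) (trans (cong +_ M≡M′d) (ℤP.pos-* M′ d)) v≡v′d ⟩
    k ℤ.* (+ M′ ℤ.* + d) ℤ.* u ℤ.+ δ ℤ.* (v′ ℤ.* + d)
      ≡⟨ regroup k (+ M′) (+ d) u δ v′ ⟩
    (δ ℤ.* v′ ℤ.+ k ℤ.* (+ M′ ℤ.* u)) ℤ.* + d
      ≡⟨ cong (ℤ._* + d) δv′+kM′u≡1 ⟩
    1ℤ ℤ.* + d
      ≡⟨ ℤP.*-identityˡ (+ d) ⟩
    + d ∎)
    where
    δ⊥k : Coprime δ k
    δ⊥k = v′ , + M′ ℤ.* u , trans (cong₂ ℤ._+_ (ℤP.*-comm v′ δ) (ℤP.*-comm (+ M′ ℤ.* u) k)) δv′+kM′u≡1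

InCusp-denominator : ∀ {M M′ d y u v v′} → M ≢ 0 → y ∼ pt u v → Coprime u v →
  v ≡ v′ ℤ.* + d → M ≡ M′ ℕ.* d → Coprime v′ (+ M′) → ∃[ a ] Coprime a (+ d) × InCusp M a d y
InCusp-denominator {M} {d = d} {y} {u} {v} M≢0 y∼u/v u⊥v v≡v′d M≡M′d v′⊥M′ =
  complete (bottom-row M≢0 u⊥v v≡v′d M≡M′d v′⊥M′)
  where
  unfold-det : ∀ σ δ τ c → σ ℤ.* δ ℤ.- ℤ.- τ ℤ.* c ≡ σ ℤ.* δ ℤ.+ τ ℤ.* c
  unfold-det = solve-∀ ℤ-ring
  complete : (∃₂ λ k δ → Coprime δ (k ℤ.* + M) × k ℤ.* + M ℤ.* u ℤ.+ δ ℤ.* v ≡ + d) →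
             ∃[ a ] Coprime a (+ d) × InCusp M a d y
  complete (k , δ , (σ , τ , σδ+τkM≡1) , kMu+δv≡d) =
    σ ℤ.* u ℤ.+ ℤ.- τ ℤ.* v ,
    subst (Coprime _) kMu+δv≡d (coprime-act σ (ℤ.- τ) (k ℤ.* + M) δ det≡1 u⊥v) ,
    InCusp-intro γ y∼u/v refl kMu+δv≡d
    where
    det≡1 : σ ℤ.* δ ℤ.- ℤ.- τ ℤ.* (k ℤ.* + M) ≡ 1ℤ
    det≡1 = trans (unfold-det σ δ τ (k ℤ.* + M)) σδ+τkM≡1
    γ : Γ₀ℤ M
    γ = record { A = σ ; B = ℤ.- τ ; C = k ℤ.* + M ; D = δ ; k = k ; det≡1 = det≡1 ; C≡kM = refl }

-- A point x/N with x ∈ [1/1]_N, in lowest terms u/(N₁·v) where N = N₁·g and gcd(v, N) = 1.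
record Reduced-0/N (N : ℕ) (y : Pt) : Set where
  field
    u v : ℤ
    N₁ g : ℕ
    N≡N₁g : N ≡ N₁ ℕ.* g
    y∼u/N₁v : y ∼ pt u (+ N₁ ℤ.* v)
    u⊥N₁v : Coprime u (+ N₁ ℤ.* v)
    v⊥N : Coprime v (+ N)
    v⊥u : Coprime v u

InCuspDivN-0⇒ : ∀ {N y} → N ≢ 0 → InCuspDivN N (+ 1) 1 y → Reduced-0/N N y
InCuspDivN-0⇒ {N} {y} N≢0 (x , x-valid , x∈[1/1] , y∼x/N) = reduce (InCusp-0⇒ {N} {x} x∈[1/1])
  where
  reduce : (∃₂ λ u v → x ∼ pt u v × Coprime u v × Coprime v (+ N)) → Reduced-0/N N y
  reduce (u₀ , v , x∼u₀/v , u₀⊥v , v⊥N) = cancel-gcd (gcdSplit u₀ N N≢0)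
    where
    cancel-gcd : GcdSplit u₀ N → Reduced-0/N N y
    cancel-gcd record { g = g ; M′ = N₁ ; x′ = u ; x≡x′*g = u₀≡ug ; M≡M′*g = N≡N₁g ; coprime = u⊥N₁ } =
      record { u = u ; v = v ; N₁ = N₁ ; g = g ; N≡N₁g = N≡N₁g
             ; y∼u/N₁v = ∼-unscale {y} {u} {+ N₁ ℤ.* v} (+ g) g≢0
                           (subst₂ (λ a b → y ∼ pt a b) u₀≡gu Nv≡g[N₁v]
                             (∼-divN {N} {x} {y} {u₀} {v} N≢0 x-valid y∼x/N x∼u₀/v))
             ; u⊥N₁v = coprime-*ʳ u⊥N₁ u⊥v
             ; v⊥N = v⊥N
             ; v⊥u = coprime-sym u⊥v }
      where
      g≢0 : + g ≢ 0ℤ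
      g≢0 g≡0 = N≢0 (trans N≡N₁g (trans (cong (N₁ ℕ.*_) (ℤP.+-injective g≡0)) (ℕP.*-zeroʳ N₁)))
      u₀≡gu : u₀ ≡ + g ℤ.* u
      u₀≡gu = trans u₀≡ug (ℤP.*-comm u (+ g))
      swap : ∀ a b c → a ℤ.* b ℤ.* c ≡ b ℤ.* (a ℤ.* c)
      swap = solve-∀ ℤ-ring
      Nv≡g[N₁v] : + N ℤ.* v ≡ + g ℤ.* (+ N₁ ℤ.* v)
      Nv≡g[N₁v] = trans (cong (ℤ._* v) (trans (cong +_ N≡N₁g) (ℤP.pos-* N₁ g))) (swap (+ N₁) (+ g) v)
      u⊥v : Coprime u v
      u⊥v = coprime-∣ˡ u₀⊥v (divides (+ g) u₀≡gu)

InCuspDivN-∞⇒ : ∀ {N y} → N ≢ 0 → InCuspDivN N (+ 1) N y →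
  ∃₂ λ u w → y ∼ pt u (w ℤ.* + (N * N)) × Coprime u (w ℤ.* + (N * N))
InCuspDivN-∞⇒ {N} {y} N≢0 (x , x-valid , x∈[1/N] , y∼x/N) =
  let u , v , x∼u/v , u⊥v , N∣v = InCusp-∞⇒ x∈[1/N] in rescale x∼u/v u⊥v N∣v
  where
  swap : ∀ n w → n ℤ.* (w ℤ.* n) ≡ w ℤ.* (n ℤ.* n)
  swap = solve-∀ ℤ-ring
  rescale : ∀ {u v} → x ∼ pt u v → Coprime u v → + N ∣ᶻ v →
            ∃₂ λ u w → y ∼ pt u (w ℤ.* + (N * N)) × Coprime u (w ℤ.* + (N * N))
  rescale {u} {v} x∼u/v u⊥v N∣v@(divides w v≡wN) =
    u , w , subst (λ t → y ∼ pt u t) Nv≡wN² (∼-divN {N} {x} {y} {u} {v} N≢0 x-valid y∼x/N x∼u/v) ,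
    subst (Coprime u) Nv≡wN² (coprime-*ʳ (coprime-∣ʳ u⊥v N∣v) u⊥v)
    where
    Nv≡wN² : + N ℤ.* v ≡ w ℤ.* + (N * N)
    Nv≡wN² = begin
      + N ℤ.* v               ≡⟨ cong (+ N ℤ.*_) v≡wN ⟩
      + N ℤ.* (w ℤ.* + N)     ≡⟨ swap (+ N) w ⟩
      w ℤ.* (+ N ℤ.* + N)     ≡⟨ cong (w ℤ.*_) (ℤP.pos-* N N) ⟨
      w ℤ.* + (N * N)         ∎


-- g Tʰ g⁻¹ for any g of determinant 1 with first column (a, c), see conj-T.
parabolic : ℚ → ℚ → ℚ → M2
parabolic a c h = mat (1ℚ ℚ.- a ℚ.* c ℚ.* h) (a ℚ.* a ℚ.* h) (ℚ.- (c ℚ.* c ℚ.* h)) (1ℚ ℚ.+ a ℚ.* c ℚ.* h)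

det-parabolic : ∀ a c h → det (parabolic a c h) ≡ 1ℚ
det-parabolic = expand
  where
  expand : ∀ a c h → (1ℚ ℚ.- a ℚ.* c ℚ.* h) ℚ.* (1ℚ ℚ.+ a ℚ.* c ℚ.* h) ℚ.- a ℚ.* a ℚ.* h ℚ.* ℚ.- (c ℚ.* c ℚ.* h)
                     ≡ 1ℚ
  expand = solve-∀ ℚ-ring

conj-T : ∀ a b c d h → det (mat a b c d) ≡ 1ℚ → mat a b c d ⊗ (T h ⊗ adj (mat a b c d)) ≡ parabolic a c h
conj-T a b c d h det≡1 =
  mat-cong (trans (top-left a b c d h) (cong (λ Δ → Δ ℚ.- a ℚ.* c ℚ.* h) det≡1)) (top-right a b h)
           (bottom-left c d h) (trans (bottom-right a b c d h) (cong (λ Δ → Δ ℚ.+ a ℚ.* c ℚ.* h) det≡1))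
  where
  top-left : ∀ a b c d h → a ℚ.* (1ℚ ℚ.* d ℚ.+ h ℚ.* ℚ.- c) ℚ.+ b ℚ.* (0ℚ ℚ.* d ℚ.+ 1ℚ ℚ.* ℚ.- c) ≡
                           (a ℚ.* d ℚ.- b ℚ.* c) ℚ.- a ℚ.* c ℚ.* h
  top-left = solve-∀ ℚ-ring
  top-right : ∀ a b h → a ℚ.* (1ℚ ℚ.* ℚ.- b ℚ.+ h ℚ.* a) ℚ.+ b ℚ.* (0ℚ ℚ.* ℚ.- b ℚ.+ 1ℚ ℚ.* a) ≡ a ℚ.* a ℚ.* h
  top-right = solve-∀ ℚ-ring
  bottom-left : ∀ c d h → c ℚ.* (1ℚ ℚ.* d ℚ.+ h ℚ.* ℚ.- c) ℚ.+ d ℚ.* (0ℚ ℚ.* d ℚ.+ 1ℚ ℚ.* ℚ.- c) ≡ ℚ.- (c ℚ.* c ℚ.* h)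
  bottom-left = solve-∀ ℚ-ring
  bottom-right : ∀ a b c d h → c ℚ.* (1ℚ ℚ.* ℚ.- b ℚ.+ h ℚ.* a) ℚ.+ d ℚ.* (0ℚ ℚ.* ℚ.- b ℚ.+ 1ℚ ℚ.* a) ≡
                               (a ℚ.* d ℚ.- b ℚ.* c) ℚ.+ a ℚ.* c ℚ.* h
  bottom-right = solve-∀ ℚ-ring

parabolic-scale : ∀ l a c h → l ℚ.* l ≡ 1ℚ → parabolic (l ℚ.* a) (l ℚ.* c) h ≡ parabolic a c h
parabolic-scale l a c h l²≡1 =
  mat-cong (cong (λ x → 1ℚ ℚ.- x) (unscale a c)) (unscale a a)
           (cong ℚ.-_ (unscale c c)) (cong (λ x → 1ℚ ℚ.+ x) (unscale a c))
  where
  unscale : ∀ x y → l ℚ.* x ℚ.* (l ℚ.* y) ℚ.* h ≡ x ℚ.* y ℚ.* h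
  unscale x y = begin
    l ℚ.* x ℚ.* (l ℚ.* y) ℚ.* h   ≡⟨ solve (l ∷ x ∷ y ∷ h ∷ []) ℚ-ring ⟩
    l ℚ.* l ℚ.* (x ℚ.* y ℚ.* h)   ≡⟨ cong (ℚ._* (x ℚ.* y ℚ.* h)) l²≡1 ⟩
    1ℚ ℚ.* (x ℚ.* y ℚ.* h)        ≡⟨ ℚP.*-identityˡ (x ℚ.* y ℚ.* h) ⟩
    x ℚ.* y ℚ.* h                 ∎

parabolic-unit-multiple : ∀ {A C u v} h → (∃[ l ] A ≡ l ℤ.* u × C ≡ l ℤ.* v × l ℤ.* l ≡ 1ℤ) →
                          parabolic (ι A) (ι C) h ≡ parabolic (ι u) (ι v) h
parabolic-unit-multiple {u = u} {v} h (l , refl , refl , l²≡1) = begin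
  parabolic (ι (l ℤ.* u)) (ι (l ℤ.* v)) h
    ≡⟨ cong₂ (λ a c → parabolic a c h) (ι-homo-* l u) (ι-homo-* l v) ⟩
  parabolic (ι l ℚ.* ι u) (ι l ℚ.* ι v) h
    ≡⟨ parabolic-scale (ι l) (ι u) (ι v) h (trans (sym (ι-homo-* l l)) (cong ι l²≡1)) ⟩
  parabolic (ι u) (ι v) h ∎

TransIn-intro : ∀ {G : Grp} {y u v h} → y ∼ pt u v → Coprime u v → G (parabolic (ι u) (ι v) h) → TransIn G y h
TransIn-intro {G} {y} {u} {v} {h} y∼u/v (s , t , su+tv≡1) parabolic∈G =
  g , ((u , refl) , (ℤ.- t , refl) , (v , refl) , (s , refl) , det≡1) ,
  subst (_∼ y) (sym (act-∞ (ι u) (ι (ℤ.- t)) (ι v) (ι s))) (∼-sym {y} {pt u v} y∼u/v) ,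
  inj₁ (subst G (sym (conj-T (ι u) (ι (ℤ.- t)) (ι v) (ι s) h det≡1)) parabolic∈G)
  where
  g : M2
  g = matℤ u (ℤ.- t) v s
  expand : ∀ u t v s → u ℤ.* s ℤ.- ℤ.- t ℤ.* v ≡ s ℤ.* u ℤ.+ t ℤ.* v
  expand = solve-∀ ℤ-ring
  det≡1 : det g ≡ 1ℚ
  det≡1 = trans (det-matℤ u (ℤ.- t) v s) (cong ι (trans (expand u t v s) su+tv≡1))

-- g·∞ ∼ u/v forces the first column of g to be ±(u, v).
TransIn-elim : ∀ {G : Grp} {y u v h} → NegClosed G → ValidPt y → y ∼ pt u v → Coprime u v →
               TransIn G y h → G (parabolic (ι u) (ι v) h)
TransIn-elim {G} {y} {u} {v} {h} G-neg y-valid y∼u/v u⊥v (g , g∈SL , g∞∼y , conj∈G)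
  with SL2Z-elim g∈SL
... | A , B , C , D , refl , det≡1 = subst G conj≡parabolic ([ id , G-neg _ ]′ conj∈G)
  where
  expand : ∀ A B C D → D ℤ.* A ℤ.+ ℤ.- B ℤ.* C ≡ A ℤ.* D ℤ.- B ℤ.* C
  expand = solve-∀ ℤ-ring
  A⊥C : Coprime A C
  A⊥C = D , ℤ.- B , trans (expand A B C D) det≡1
  A/C∼u/v : pt A C ∼ pt u v
  A/C∼u/v = ∼-trans {pt A C} {y} {pt u v} y-valid (subst (_∼ y) (act-∞ (ι A) (ι B) (ι C) (ι D)) g∞∼y) y∼u/v
  Av≡uC : A ℤ.* v ≡ u ℤ.* C
  Av≡uC = ι-injective (trans (ι-homo-* A v) (trans A/C∼u/v (sym (ι-homo-* u C))))
  conj≡parabolic : matℤ A B C D ⊗ (T h ⊗ adj (matℤ A B C D)) ≡ parabolic (ι u) (ι v) h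
  conj≡parabolic = trans (conj-T (ι A) (ι B) (ι C) (ι D) h (trans (det-matℤ A B C D) (cong ι det≡1)))
                         (parabolic-unit-multiple h (coprime-proportional u⊥v A⊥C Av≡uC))

TransIn-mono : ∀ {G H : Grp} {y h} → G ⊆ H → TransIn G y h → TransIn H y h
TransIn-mono G⊆H (g , g∈SL , g∞∼y , conj∈G) = g , g∈SL , g∞∼y , ⊎-map G⊆H G⊆H conj∈G

IsWidth-transport : ∀ {G H : Grp} {y w} → (∀ h → TransIn G y h → TransIn H y h) →
                    (∀ h → TransIn H y h → TransIn G y h) → IsWidth H y w → IsWidth G y w
IsWidth-transport {w = w} G→H H→G (0<w , w∈H , minimal) =
  0<w , H→G w w∈H , λ h 0<h h∈G → minimal h 0<h (G→H h h∈G)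

width-of-lattice : ∀ {G y w} → 0ℚ ℚ.< w → TransIn G y w →
                   (∀ h → TransIn G y h → ∃[ k ] h ≡ ι k ℚ.* w) → IsWidth G y w
width-of-lattice {G} {y} {w} 0<w w-trans lattice = 0<w , w-trans , minimal
  where
  instance
    w-nonNeg : ℚ.NonNegative w
    w-nonNeg = ℚ.nonNegative (ℚP.<⇒≤ 0<w)
  minimal : ∀ h → 0ℚ ℚ.< h → TransIn G y h → w ℚ.≤ h
  minimal h 0<h h-trans with lattice h h-trans
  ... | k , refl = subst (ℚ._≤ ι k ℚ.* w) (ℚP.*-identityˡ w) (ℚP.*-monoʳ-≤-nonNeg w (ι-mono-≤ 1≤k))
    where
    1≤k : 1ℤ ℤ.≤ k
    1≤k = ℤP.i<j⇒suc[i]≤j (ι-cancel-< {0ℤ} {k}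
            (ℚP.*-cancelʳ-<-nonNeg w (subst (ℚ._< ι k ℚ.* w) (sym (ℚP.*-zeroˡ w)) 0<h)))

ι-parabolic : ∀ u v z → parabolic (ι u) (ι v) (ι z) ≡
  matℤ (1ℤ ℤ.- u ℤ.* v ℤ.* z) (u ℤ.* u ℤ.* z) (ℤ.- (v ℤ.* v ℤ.* z)) (1ℤ ℤ.+ u ℤ.* v ℤ.* z)
ι-parabolic u v z = sym (mat-cong
  (trans (ι-homo-+ 1ℤ (ℤ.- (u ℤ.* v ℤ.* z)))
         (cong (1ℚ ℚ.+_) (trans (ι-homo‿- (u ℤ.* v ℤ.* z)) (cong ℚ.-_ (ι-*₃ u v z)))))
  (ι-*₃ u u z)
  (trans (ι-homo‿- (v ℤ.* v ℤ.* z)) (cong ℚ.-_ (ι-*₃ v v z)))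
  (trans (ι-homo-+ 1ℤ (u ℤ.* v ℤ.* z)) (cong (1ℚ ℚ.+_) (ι-*₃ u v z))))

parabolic∈Γ₀⇐ : ∀ {M u v z} → + M ∣ᶻ v ℤ.* v ℤ.* z → Γ₀ M (parabolic (ι u) (ι v) (ι z))
parabolic∈Γ₀⇐ {M} {u} {v} {z} (divides q v²z≡qM) = subst (Γ₀ M) (sym (ι-parabolic u v z)) (Γ₀ℤ-sound γ)
  where
  determinant : ∀ u v z → (1ℤ ℤ.- u ℤ.* v ℤ.* z) ℤ.* (1ℤ ℤ.+ u ℤ.* v ℤ.* z)
                           ℤ.- u ℤ.* u ℤ.* z ℤ.* ℤ.- (v ℤ.* v ℤ.* z) ≡ 1ℤ
  determinant = solve-∀ ℤ-ring
  γ : Γ₀ℤ M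
  γ = record
    { A = 1ℤ ℤ.- u ℤ.* v ℤ.* z ; B = u ℤ.* u ℤ.* z ; C = ℤ.- (v ℤ.* v ℤ.* z) ; D = 1ℤ ℤ.+ u ℤ.* v ℤ.* z
    ; k = ℤ.- q ; det≡1 = determinant u v z
    ; C≡kM = trans (cong ℤ.-_ v²z≡qM) (ℤP.neg-distribˡ-* q (+ M)) }

ι-divides : ∀ {M v z k} → ℚ.- (ι v ℚ.* ι v ℚ.* ι z) ≡ ι (k ℤ.* + M) → + M ∣ᶻ v ℤ.* v ℤ.* z
ι-divides {M} {v} {z} {k} -v²z≡kM = divides (ℤ.- k) (begin
  v ℤ.* v ℤ.* z           ≡⟨ ℤP.neg-involutive _ ⟨
  ℤ.- ℤ.- (v ℤ.* v ℤ.* z) ≡⟨ cong ℤ.-_ (ι-injective {ℤ.- (v ℤ.* v ℤ.* z)} ι[-v²z]≡ι[kM]) ⟩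
  ℤ.- (k ℤ.* + M)         ≡⟨ ℤP.neg-distribˡ-* k (+ M) ⟩
  ℤ.- k ℤ.* + M           ∎)
  where
  ι[-v²z]≡ι[kM] : ι (ℤ.- (v ℤ.* v ℤ.* z)) ≡ ι (k ℤ.* + M)
  ι[-v²z]≡ι[kM] = trans (ι-homo‿- (v ℤ.* v ℤ.* z)) (trans (cong ℚ.-_ (ι-*₃ v v z)) -v²z≡kM)

parabolic∈Γ₀⇒ : ∀ {M u v h} → Coprime u v → Γ₀ M (parabolic (ι u) (ι v) h) →
                ∃[ z ] h ≡ ι z × + M ∣ᶻ v ℤ.* v ℤ.* z
parabolic∈Γ₀⇒ {M} {u} {v} {h} u⊥v ((_ , u²h∈ℤ , -v²h∈ℤ , _ , _) , k , -v²h≡kM) =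
  conclude (IsInt-coprime u²⊥v² (subst IsInt (ι²-* u) u²h∈ℤ)
                                (subst IsInt (trans (ℚ-neg-involutive _) (ι²-* v)) (IsInt-‿- -v²h∈ℤ)))
  where
  ι²-* : ∀ x → ι x ℚ.* ι x ℚ.* h ≡ ι (x ℤ.* x) ℚ.* h
  ι²-* x = cong (ℚ._* h) (sym (ι-homo-* x x))
  u²⊥v² : Coprime (u ℤ.* u) (v ℤ.* v)
  u²⊥v² = coprime-*ˡ (coprime-*ʳ u⊥v u⊥v) (coprime-*ʳ u⊥v u⊥v)
  conclude : IsInt h → ∃[ z ] h ≡ ι z × + M ∣ᶻ v ℤ.* v ℤ.* z
  conclude (z , h≡z) =
    z , h≡z , ι-divides {M} {v} {z} {k} (subst (λ t → ℚ.- (ι v ℚ.* ι v ℚ.* t) ≡ ι (k ℤ.* + M)) h≡z -v²h≡kM)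

Γ₀-width : ∀ {M y u v} m w q → m ≢ 0 → w ≢ 0 → M ≡ m ℕ.* w → v ℤ.* v ≡ q ℤ.* + m → Coprime q (+ w) →
           ValidPt y → y ∼ pt u v → Coprime u v → IsWidth (Γ₀ M) y (ℕ→ℚ w)
Γ₀-width {M} {y} {u} {v} m w q m≢0 w≢0 M≡mw v²≡qm q⊥w y-valid y∼u/v u⊥v =
  width-of-lattice {Γ₀ M} {y} (ι-mono-< (ℤ.+<+ (ℕP.n≢0⇒n>0 w≢0)))
    (TransIn-intro {Γ₀ M} {y} y∼u/v u⊥v (parabolic∈Γ₀⇐ {M} {u} {v} {+ w} M∣v²w)) lattice
  where
  instance
    m-nonZero : ℤ.NonZero (+ m)
    m-nonZero = ℤ.≢-nonZero (λ m≡0 → m≢0 (ℤP.+-injective m≡0))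
  M≡m*w : + M ≡ + m ℤ.* + w
  M≡m*w = trans (cong +_ M≡mw) (ℤP.pos-* m w)
  M∣v²w : + M ∣ᶻ v ℤ.* v ℤ.* + w
  M∣v²w = divides q (begin
    v ℤ.* v ℤ.* + w       ≡⟨ cong (ℤ._* + w) v²≡qm ⟩
    q ℤ.* + m ℤ.* + w     ≡⟨ ℤP.*-assoc q (+ m) (+ w) ⟩
    q ℤ.* (+ m ℤ.* + w)   ≡⟨ cong (q ℤ.*_) M≡m*w ⟨
    q ℤ.* + M             ∎)
  swap : ∀ a b c → a ℤ.* b ℤ.* c ≡ b ℤ.* (a ℤ.* c)
  swap = solve-∀ ℤ-ring
  v²z≡m[qz] : ∀ z → v ℤ.* v ℤ.* z ≡ + m ℤ.* (q ℤ.* z)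
  v²z≡m[qz] z = trans (cong (ℤ._* z) v²≡qm) (swap q (+ m) z)
  lattice : ∀ h → TransIn (Γ₀ M) y h → ∃[ k ] h ≡ ι k ℚ.* ℕ→ℚ w
  lattice h h-trans =
    multiple-of-w (parabolic∈Γ₀⇒ u⊥v (TransIn-elim {Γ₀ M} Γ₀-negClosed y-valid y∼u/v u⊥v h-trans))
    where
    multiple-of-w : (∃[ z ] h ≡ ι z × + M ∣ᶻ v ℤ.* v ℤ.* z) → ∃[ k ] h ≡ ι k ℚ.* ℕ→ℚ w
    multiple-of-w (z , h≡z , M∣v²z) =
      let divides k z≡kw = coprime-divisor q⊥w (*-cancelˡ-∣ (+ m) (subst₂ _∣ᶻ_ M≡m*w (v²z≡m[qz] z) M∣v²z))
      in k , trans h≡z (trans (cong ι z≡kw) (ι-homo-* k (+ w)))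

parabolic-1/N∈Γ₀′ : ∀ {N r} u w → ℕ→ℚ N ℚ.* r ≡ 1ℚ → Γ₀' N (parabolic (ι u) (ι (w ℤ.* + (N ℕ.* N))) r)
parabolic-1/N∈Γ₀′ {N} {r} u w nr≡1 =
  Γ₀′-intro _ (1ℤ ℤ.- x) (u ℤ.* u) (ℤ.- (w ℤ.* w ℤ.* + N)) (1ℤ ℤ.+ x) a≡ Nb≡ c≡ d≡
    (det-parabolic (ι u) (ι (w ℤ.* + (N ℕ.* N))) r)
  where
  n : ℚ
  n = ℕ→ℚ N
  x : ℤ
  x = u ℤ.* w ℤ.* + N
  ιc : ι (w ℤ.* + (N ℕ.* N)) ≡ ι w ℚ.* n ℚ.* n
  ιc = trans (ι[k*N*N] w N) (cong (ℚ._* n) (ι-homo-* w (+ N)))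
  shuffle-a : ∀ U W n r → U ℚ.* (W ℚ.* n ℚ.* n) ℚ.* r ≡ U ℚ.* W ℚ.* n ℚ.* (n ℚ.* r)
  shuffle-a = solve-∀ ℚ-ring
  shuffle-c : ∀ W n r → ℚ.- (W ℚ.* n ℚ.* n ℚ.* (W ℚ.* n ℚ.* n) ℚ.* r) ≡
                        ℚ.- (W ℚ.* W ℚ.* n) ℚ.* (n ℚ.* n) ℚ.* (n ℚ.* r)
  shuffle-c = solve-∀ ℚ-ring
  ucr≡x : ι u ℚ.* ι (w ℤ.* + (N ℕ.* N)) ℚ.* r ≡ ι x
  ucr≡x = begin
    ι u ℚ.* ι (w ℤ.* + (N ℕ.* N)) ℚ.* r   ≡⟨ cong (λ t → ι u ℚ.* t ℚ.* r) ιc ⟩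
    ι u ℚ.* (ι w ℚ.* n ℚ.* n) ℚ.* r       ≡⟨ shuffle-a (ι u) (ι w) n r ⟩
    ι u ℚ.* ι w ℚ.* n ℚ.* (n ℚ.* r)       ≡⟨ cong (ι u ℚ.* ι w ℚ.* n ℚ.*_) nr≡1 ⟩
    ι u ℚ.* ι w ℚ.* n ℚ.* 1ℚ              ≡⟨ ℚP.*-identityʳ _ ⟩
    ι u ℚ.* ι w ℚ.* n                     ≡⟨ ι-*₃ u w (+ N) ⟨
    ι x                                   ∎
  a≡ : 1ℚ ℚ.- ι u ℚ.* ι (w ℤ.* + (N ℕ.* N)) ℚ.* r ≡ ι (1ℤ ℤ.- x)
  a≡ = trans (cong (λ t → 1ℚ ℚ.- t) ucr≡x) (sym (trans (ι-homo-+ 1ℤ (ℤ.- x)) (cong (1ℚ ℚ.+_) (ι-homo‿- x))))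
  d≡ : 1ℚ ℚ.+ ι u ℚ.* ι (w ℤ.* + (N ℕ.* N)) ℚ.* r ≡ ι (1ℤ ℤ.+ x)
  d≡ = trans (cong (1ℚ ℚ.+_) ucr≡x) (sym (ι-homo-+ 1ℤ x))
  Nb≡ : n ℚ.* (ι u ℚ.* ι u ℚ.* r) ≡ ι (u ℤ.* u)
  Nb≡ = begin
    n ℚ.* (ι u ℚ.* ι u ℚ.* r)     ≡⟨ x∙yz≈y∙xz n (ι u ℚ.* ι u) r ⟩
    ι u ℚ.* ι u ℚ.* (n ℚ.* r)     ≡⟨ cong (ι u ℚ.* ι u ℚ.*_) nr≡1 ⟩
    ι u ℚ.* ι u ℚ.* 1ℚ            ≡⟨ ℚP.*-identityʳ _ ⟩
    ι u ℚ.* ι u                   ≡⟨ ι-homo-* u u ⟨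
    ι (u ℤ.* u)                   ∎
  c≡ : ℚ.- (ι (w ℤ.* + (N ℕ.* N)) ℚ.* ι (w ℤ.* + (N ℕ.* N)) ℚ.* r) ≡
       ι (ℤ.- (w ℤ.* w ℤ.* + N) ℤ.* + (N ℕ.* N))
  c≡ = begin
    ℚ.- (ι (w ℤ.* + (N ℕ.* N)) ℚ.* ι (w ℤ.* + (N ℕ.* N)) ℚ.* r)
      ≡⟨ cong (λ t → ℚ.- (t ℚ.* t ℚ.* r)) ιc ⟩
    ℚ.- (ι w ℚ.* n ℚ.* n ℚ.* (ι w ℚ.* n ℚ.* n) ℚ.* r)
      ≡⟨ shuffle-c (ι w) n r ⟩
    ℚ.- (ι w ℚ.* ι w ℚ.* n) ℚ.* (n ℚ.* n) ℚ.* (n ℚ.* r)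
      ≡⟨ cong (ℚ.- (ι w ℚ.* ι w ℚ.* n) ℚ.* (n ℚ.* n) ℚ.*_) nr≡1 ⟩
    ℚ.- (ι w ℚ.* ι w ℚ.* n) ℚ.* (n ℚ.* n) ℚ.* 1ℚ
      ≡⟨ ℚP.*-identityʳ _ ⟩
    ℚ.- (ι w ℚ.* ι w ℚ.* n) ℚ.* (n ℚ.* n)
      ≡⟨ cong₂ ℚ._*_ (trans (ι-homo‿- (w ℤ.* w ℤ.* + N)) (cong ℚ.-_ (ι-*₃ w w (+ N)))) (ℕ→ℚ-homo-* N N) ⟨
    ι (ℤ.- (w ℤ.* w ℤ.* + N)) ℚ.* ι (+ (N ℕ.* N))
      ≡⟨ ι-homo-* (ℤ.- (w ℤ.* w ℤ.* + N)) (+ (N ℕ.* N)) ⟨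
    ι (ℤ.- (w ℤ.* w ℤ.* + N) ℤ.* + (N ℕ.* N)) ∎

parabolic∈Γ₀′⇒ : ∀ {N u v h} → Coprime u v → Γ₀' N (parabolic (ι u) (ι v) h) → IsInt (ℕ→ℚ N ℚ.* h)
parabolic∈Γ₀′⇒ {N} {u} {v} {h} u⊥v parabolic∈Γ₀′ =
  integral (Γ₀′-elim {N} {parabolic (ι u) (ι v) h} parabolic∈Γ₀′)
  where
  n : ℚ
  n = ℕ→ℚ N
  u²⊥v² : Coprime (u ℤ.* u) (v ℤ.* v)
  u²⊥v² = coprime-*ˡ (coprime-*ʳ u⊥v u⊥v) (coprime-*ʳ u⊥v u⊥v)
  integral : IsInt (n ℚ.* (ι u ℚ.* ι u ℚ.* h)) × (∃[ K ] ℚ.- (ι v ℚ.* ι v ℚ.* h) ≡ ι (K ℤ.* + (N ℕ.* N))) →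
             IsInt (n ℚ.* h)
  integral (Nu²h∈ℤ , K , -v²h≡KN²) = IsInt-coprime u²⊥v² u²Nh∈ℤ v²Nh∈ℤ
    where
    u²Nh∈ℤ : IsInt (ι (u ℤ.* u) ℚ.* (n ℚ.* h))
    u²Nh∈ℤ = subst IsInt (trans (cong (λ t → n ℚ.* (t ℚ.* h)) (sym (ι-homo-* u u))) (x∙yz≈y∙xz n (ι (u ℤ.* u)) h))
                   Nu²h∈ℤ
    v²h≡-KN² : ι (v ℤ.* v) ℚ.* h ≡ ι (ℤ.- (K ℤ.* + (N ℕ.* N)))
    v²h≡-KN² = begin
      ι (v ℤ.* v) ℚ.* h            ≡⟨ cong (ℚ._* h) (ι-homo-* v v) ⟩
      ι v ℚ.* ι v ℚ.* h            ≡⟨ ℚ-neg-involutive _ ⟨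
      ℚ.- ℚ.- (ι v ℚ.* ι v ℚ.* h)  ≡⟨ cong ℚ.-_ -v²h≡KN² ⟩
      ℚ.- ι (K ℤ.* + (N ℕ.* N))    ≡⟨ ι-homo‿- (K ℤ.* + (N ℕ.* N)) ⟨
      ι (ℤ.- (K ℤ.* + (N ℕ.* N)))  ∎
    v²Nh∈ℤ : IsInt (ι (v ℤ.* v) ℚ.* (n ℚ.* h))
    v²Nh∈ℤ = subst IsInt (x∙yz≈y∙xz n (ι (v ℤ.* v)) h)
                   (IsInt-* (+ N , refl) (ℤ.- (K ℤ.* + (N ℕ.* N)) , v²h≡-KN²))

Γ₀′-width : ∀ {N y u w r} → ℕ→ℚ N ℚ.* r ≡ 1ℚ → ValidPt y → y ∼ pt u (w ℤ.* + (N ℕ.* N)) →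
            Coprime u (w ℤ.* + (N ℕ.* N)) → IsWidth (Γ₀' N) y r
Γ₀′-width {N} {y} {u} {w} {r} nr≡1 y-valid y∼u/v u⊥v =
  width-of-lattice {Γ₀' N} {y} 0<r (TransIn-intro {Γ₀' N} {y} y∼u/v u⊥v (parabolic-1/N∈Γ₀′ u w nr≡1)) lattice
  where
  n : ℚ
  n = ℕ→ℚ N
  instance
    n-nonNeg : ℚ.NonNegative n
    n-nonNeg = ℚ.nonNegative (ι-mono-≤ {0ℤ} {+ N} (ℤ.+≤+ ℕ.z≤n))
  0<r : 0ℚ ℚ.< r
  0<r = ℚP.*-cancelˡ-<-nonNeg n
          (subst₂ ℚ._<_ (sym (ℚP.*-zeroʳ n)) (sym nr≡1) (ι-mono-< {0ℤ} {1ℤ} (ℤ.+<+ (ℕ.s≤s ℕ.z≤n))))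
  swap : ∀ n r h → n ℚ.* r ℚ.* h ≡ n ℚ.* h ℚ.* r
  swap = solve-∀ ℚ-ring
  lattice : ∀ h → TransIn (Γ₀' N) y h → ∃[ k ] h ≡ ι k ℚ.* r
  lattice h h-trans =
    let z , Nh≡z = parabolic∈Γ₀′⇒ u⊥v (TransIn-elim {Γ₀' N} {y} {u} {w ℤ.* + (N ℕ.* N)} {h} (Γ₀′-negClosed {N})
                                                      y-valid y∼u/v u⊥v h-trans)
    in z , (begin
      h                    ≡⟨ ℚP.*-identityˡ h ⟨
      1ℚ ℚ.* h             ≡⟨ cong (ℚ._* h) nr≡1 ⟨
      n ℚ.* r ℚ.* h        ≡⟨ swap n r h ⟩
      n ℚ.* h ℚ.* r        ≡⟨ cong (ℚ._* r) Nh≡z ⟩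
      ι z ℚ.* r            ∎)

-- Cancelling N₁² from N² ∣ (N₁v)²h leaves v²h ∈ ℤ; together with N·u²h ∈ ℤ and
-- gcd(v², N·u²) = 1 this makes h integral.
parabolic∈Γ₀′⇒Γ₀² : ∀ {N N₁ g u v h} → N ≡ N₁ ℕ.* g → N₁ ≢ 0 → Coprime v (+ N) → Coprime v u →
  Γ₀' N (parabolic (ι u) (ι (+ N₁ ℤ.* v)) h) → Γ₀ (N ℕ.* N) (parabolic (ι u) (ι (+ N₁ ℤ.* v)) h)
parabolic∈Γ₀′⇒Γ₀² {N} {N₁} {g} {u} {v} {h} N≡N₁g N₁≢0 v⊥N v⊥u parabolic∈Γ₀′ =
  conclude (Γ₀′-elim {N} {parabolic (ι u) (ι (+ N₁ ℤ.* v)) h} parabolic∈Γ₀′)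
  where
  n₁ : ℚ
  n₁ = ℕ→ℚ N₁
  G : ℚ
  G = ℕ→ℚ g
  n₁≢0 : n₁ ≢ 0ℚ
  n₁≢0 n₁≡0 = N₁≢0 (ℤP.+-injective (ι-injective n₁≡0))
  ι[N²] : ℕ→ℚ (N ℕ.* N) ≡ n₁ ℚ.* G ℚ.* (n₁ ℚ.* G)
  ι[N²] = trans (ℕ→ℚ-homo-* N N) (cong₂ ℚ._*_ ιN ιN)
    where
    ιN : ℕ→ℚ N ≡ n₁ ℚ.* G
    ιN = trans (cong ℕ→ℚ N≡N₁g) (ℕ→ℚ-homo-* N₁ g)
  unfold : ∀ n w h → n ℚ.* n ℚ.* (w ℚ.* w ℚ.* h) ≡ ℚ.- ℚ.- (n ℚ.* w ℚ.* (n ℚ.* w) ℚ.* h)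
  unfold = solve-∀ ℚ-ring
  refold : ∀ n K G → ℚ.- (K ℚ.* (n ℚ.* G ℚ.* (n ℚ.* G))) ≡ n ℚ.* n ℚ.* ℚ.- (K ℚ.* G ℚ.* G)
  refold = solve-∀ ℚ-ring
  regroup : ∀ n u h → n ℚ.* (u ℚ.* u ℚ.* h) ≡ n ℚ.* u ℚ.* u ℚ.* h
  regroup = solve-∀ ℚ-ring
  v⊥Nu² : Coprime v (+ N ℤ.* u ℤ.* u)
  v⊥Nu² = coprime-*ʳ (coprime-*ʳ v⊥N v⊥u) v⊥u
  conclude : IsInt (ℕ→ℚ N ℚ.* (ι u ℚ.* ι u ℚ.* h)) ×
             (∃[ K ] ℚ.- (ι (+ N₁ ℤ.* v) ℚ.* ι (+ N₁ ℤ.* v) ℚ.* h) ≡ ι (K ℤ.* + (N ℕ.* N))) →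
             Γ₀ (N ℕ.* N) (parabolic (ι u) (ι (+ N₁ ℤ.* v)) h)
  conclude (Nu²h∈ℤ , K , -c²h≡KN²) =
    subst (λ t → Γ₀ (N ℕ.* N) (parabolic (ι u) (ι (+ N₁ ℤ.* v)) t)) (sym h≡z)
      (parabolic∈Γ₀⇐ {N ℕ.* N} {u} {+ N₁ ℤ.* v} {z}
        (ι-divides {N ℕ.* N} {+ N₁ ℤ.* v} {z} {K}
          (subst (λ t → ℚ.- (ι (+ N₁ ℤ.* v) ℚ.* ι (+ N₁ ℤ.* v) ℚ.* t) ≡ ι (K ℤ.* + (N ℕ.* N)))
                 h≡z -c²h≡KN²)))
    where
    v²h≡-Kg² : ι (v ℤ.* v) ℚ.* h ≡ ι (ℤ.- (K ℤ.* + g ℤ.* + g))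
    v²h≡-Kg² = *-cancel-square n₁≢0 (begin
      n₁ ℚ.* n₁ ℚ.* (ι (v ℤ.* v) ℚ.* h)
        ≡⟨ cong (λ t → n₁ ℚ.* n₁ ℚ.* (t ℚ.* h)) (ι-homo-* v v) ⟩
      n₁ ℚ.* n₁ ℚ.* (ι v ℚ.* ι v ℚ.* h)
        ≡⟨ unfold n₁ (ι v) h ⟩
      ℚ.- ℚ.- (n₁ ℚ.* ι v ℚ.* (n₁ ℚ.* ι v) ℚ.* h)
        ≡⟨ cong (λ t → ℚ.- ℚ.- (t ℚ.* t ℚ.* h)) (ι-homo-* (+ N₁) v) ⟨
      ℚ.- ℚ.- (ι (+ N₁ ℤ.* v) ℚ.* ι (+ N₁ ℤ.* v) ℚ.* h)
        ≡⟨ cong ℚ.-_ -c²h≡KN² ⟩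
      ℚ.- ι (K ℤ.* + (N ℕ.* N))
        ≡⟨ cong ℚ.-_ (trans (ι-homo-* K (+ (N ℕ.* N))) (cong (ι K ℚ.*_) ι[N²])) ⟩
      ℚ.- (ι K ℚ.* (n₁ ℚ.* G ℚ.* (n₁ ℚ.* G)))
        ≡⟨ refold n₁ (ι K) G ⟩
      n₁ ℚ.* n₁ ℚ.* ℚ.- (ι K ℚ.* G ℚ.* G)
        ≡⟨ cong (λ t → n₁ ℚ.* n₁ ℚ.* t)
                (trans (ι-homo‿- (K ℤ.* + g ℤ.* + g)) (cong ℚ.-_ (ι-*₃ K (+ g) (+ g)))) ⟨
      n₁ ℚ.* n₁ ℚ.* ι (ℤ.- (K ℤ.* + g ℤ.* + g)) ∎)
    Nu²h∈ℤ′ : IsInt (ι (+ N ℤ.* u ℤ.* u) ℚ.* h)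
    Nu²h∈ℤ′ = subst IsInt (trans (regroup (ℕ→ℚ N) (ι u) h) (cong (ℚ._* h) (sym (ι-*₃ (+ N) u u)))) Nu²h∈ℤ
    h∈ℤ : IsInt h
    h∈ℤ = IsInt-coprime (coprime-*ˡ v⊥Nu² v⊥Nu²) (ℤ.- (K ℤ.* + g ℤ.* + g) , v²h≡-Kg²) Nu²h∈ℤ′
    z : ℤ
    z = proj₁ h∈ℤ
    h≡z : h ≡ ι z
    h≡z = proj₂ h∈ℤ


InCusp-0-square : ∀ {N y} → InCusp N (+ 1) 1 y → InCusp (N * N) (+ 1) 1 y
InCusp-0-square {N} {y} y∈[1/1] =
  let u , v , y∼u/v , u⊥v , v⊥N = InCusp-0⇒ {N} {y} y∈[1/1]
  in InCusp-0 {N * N} {y} y∼u/v u⊥v (coprime-N² v⊥N)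

ramification-at-0 : ∀ {N y} → N ≢ 0 → ValidPt y → InCusp N (+ 1) 1 y → RamIndex (Γ₀ (N * N)) (Γ₀ N) y N
ramification-at-0 {N} {y} N≢0 y-valid y∈[1/1] =
  let u , v , y∼u/v , u⊥v , v⊥N = InCusp-0⇒ {N} {y} y∈[1/1]
      v²≡v²*1 = sym (ℤP.*-identityʳ (v ℤ.* v))
  in ℕ→ℚ N , ℕ→ℚ (N * N) ,
     Γ₀-width 1 N (v ℤ.* v) (λ ()) N≢0 (sym (ℕP.*-identityˡ N)) v²≡v²*1
       (coprime-*ˡ v⊥N v⊥N) y-valid y∼u/v u⊥v ,
     Γ₀-width 1 (N * N) (v ℤ.* v) (λ ()) (*-≢0 N≢0 N≢0) (sym (ℕP.*-identityˡ (N * N))) v²≡v²*1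
       (coprime-*ˡ (coprime-N² v⊥N) (coprime-N² v⊥N)) y-valid y∼u/v u⊥v ,
     ℕ→ℚ-homo-* N N

-- The denominator is d = N·gcd(v/N, N).
CuspWithDen-of-∞ : ∀ {N y u v} → N ≢ 0 → y ∼ pt u v → Coprime u v → + N ∣ᶻ v →
                   CuspWithDen (N * N) (λ d → N ∣ d) y
CuspWithDen-of-∞ {N} {y} {u} {v} N≢0 y∼u/v u⊥v (divides w v≡wN) = split-w (gcdSplit w N N≢0)
  where
  regroup : ∀ w g N → w ℤ.* g ℤ.* N ≡ w ℤ.* (N ℤ.* g)
  regroup = solve-∀ ℤ-ring
  split-w : GcdSplit w N → CuspWithDen (N * N) (λ d → N ∣ d) y
  split-w record { g = g ; M′ = N′ ; x′ = w′ ; x≡x′*g = w≡w′g ; M≡M′*g = N≡N′g ; coprime = w′⊥N′ } =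
    let a , a⊥Ng , y∈[a/Ng] = InCusp-denominator (*-≢0 N≢0 N≢0) y∼u/v u⊥v v≡w′[Ng] N²≡N′[Ng] w′⊥N′
    in N * g , a , ℕD.*-monoʳ-∣ N (ℕD.divides N′ N≡N′g) , ℕD.m∣m*n g , coprime⇒gcd≡1 a⊥Ng , y∈[a/Ng]
    where
    v≡w′[Ng] : v ≡ w′ ℤ.* + (N * g)
    v≡w′[Ng] = begin
      v                         ≡⟨ v≡wN ⟩
      w ℤ.* + N                 ≡⟨ cong (ℤ._* + N) w≡w′g ⟩
      w′ ℤ.* + g ℤ.* + N        ≡⟨ regroup w′ (+ g) (+ N) ⟩
      w′ ℤ.* (+ N ℤ.* + g)      ≡⟨ cong (w′ ℤ.*_) (ℤP.pos-* N g) ⟨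
      w′ ℤ.* + (N * g)          ∎
    N²≡N′[Ng] : N * N ≡ N′ * (N * g)
    N²≡N′[Ng] = begin
      N * N                     ≡⟨ cong (N *_) N≡N′g ⟩
      N * (N′ * g)              ≡⟨ solve (N ∷ N′ ∷ g ∷ []) ℕ-ring ⟩
      N′ * (N * g)              ∎

CuspWithDen⇒InCusp-∞ : ∀ {N y} → CuspWithDen (N * N) (λ d → N ∣ d) y → InCusp N (+ 1) N y
CuspWithDen⇒InCusp-∞ {N} (d , a , _ , N∣d , gcd≡1 , y∈[a/d]) = InCusp-∞ y∼u/v u⊥v N∣v
  where
  open Representative (InCusp⇒representative y∈[a/d] (gcd≡1⇒coprime a d gcd≡1))
  N∣v : + N ∣ᶻ v
  N∣v = subst (+ N ∣ᶻ_) (sym v≡αd+jM)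
    (∣m∣n⇒∣m+n (∣n⇒∣m*n α (∣ᵤ⇒∣ {+ N} N∣d)) (∣n⇒∣m*n j (divides (+ N) (ℤP.pos-* N N))))

ramification-at-∞ : ∀ {N y u v} → N ≢ 0 → ValidPt y → y ∼ pt u v → Coprime u v → + N ∣ᶻ v →
                    RamIndex (Γ₀ (N * N)) (Γ₀ N) y 1
ramification-at-∞ {N} {y} {u} {v} N≢0 y-valid y∼u/v u⊥v (divides w v≡wN) =
  ℕ→ℚ 1 , ℕ→ℚ 1 ,
  Γ₀-width N 1 (v ℤ.* w) N≢0 (λ ()) (sym (ℕP.*-identityʳ N)) v²≡vw*N (coprime-1ʳ _) y-valid y∼u/v u⊥v ,
  Γ₀-width (N * N) 1 (w ℤ.* w) (*-≢0 N≢0 N≢0) (λ ()) (sym (ℕP.*-identityʳ (N * N))) v²≡w²*N²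
    (coprime-1ʳ _) y-valid y∼u/v u⊥v ,
  sym (ℚP.*-identityˡ (ℕ→ℚ 1))
  where
  v²≡vw*N : v ℤ.* v ≡ v ℤ.* w ℤ.* + N
  v²≡vw*N = trans (cong (v ℤ.*_) v≡wN) (sym (ℤP.*-assoc v w (+ N)))
  square : ∀ w N → w ℤ.* N ℤ.* (w ℤ.* N) ≡ w ℤ.* w ℤ.* (N ℤ.* N)
  square = solve-∀ ℤ-ring
  v²≡w²*N² : v ℤ.* v ≡ w ℤ.* w ℤ.* + (N * N)
  v²≡w²*N² = begin
    v ℤ.* v                        ≡⟨ cong₂ ℤ._*_ v≡wN v≡wN ⟩
    w ℤ.* + N ℤ.* (w ℤ.* + N)      ≡⟨ square w (+ N) ⟩
    w ℤ.* w ℤ.* (+ N ℤ.* + N)      ≡⟨ cong (w ℤ.* w ℤ.*_) (ℤP.pos-* N N) ⟨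
    w ℤ.* w ℤ.* + (N * N)          ∎

CuspWithDen-of-0/N : ∀ {N y} → N ≢ 0 → Reduced-0/N N y → CuspWithDen (N * N) (λ d → d ∣ N) y
CuspWithDen-of-0/N {N} {y} N≢0
  record { u = u ; v = v ; N₁ = N₁ ; g = g ; N≡N₁g = N≡N₁g
         ; y∼u/N₁v = y∼u/N₁v ; u⊥N₁v = u⊥N₁v ; v⊥N = v⊥N } =
  let a , a⊥N₁ , y∈[a/N₁] = InCusp-denominator {N * N} {g * N} {N₁} {y} {u} {+ N₁ ℤ.* v} {v}
                              (*-≢0 N≢0 N≢0) y∼u/N₁v u⊥N₁v (ℤP.*-comm (+ N₁) v) N²≡[gN]N₁ v⊥gN
  in N₁ , a , ℕD.∣-trans N₁∣N (ℕD.m∣m*n N) , N₁∣N , coprime⇒gcd≡1 a⊥N₁ , y∈[a/N₁]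
  where
  N₁∣N : N₁ ∣ N
  N₁∣N = ℕD.divides g (trans N≡N₁g (ℕP.*-comm N₁ g))
  N²≡[gN]N₁ : N * N ≡ g * N * N₁
  N²≡[gN]N₁ = begin
    N * N              ≡⟨ cong (_* N) N≡N₁g ⟩
    N₁ * g * N         ≡⟨ solve (N₁ ∷ g ∷ N ∷ []) ℕ-ring ⟩
    g * N * N₁         ∎
  v⊥gN : Coprime v (+ (g * N))
  v⊥gN = subst (Coprime v) (sym (ℤP.pos-* g N))
    (coprime-*ʳ (coprime-∣ʳ v⊥N (divides (+ N₁) (trans (cong +_ N≡N₁g) (ℤP.pos-* N₁ g)))) v⊥N)

-- With N = N′·d and v = d·v₁, the point x = N′u/v₁ satisfies x/N ∼ u/v.
CuspWithDen⇒InCuspDivN-0 : ∀ {N y} → CuspWithDen (N * N) (λ d → d ∣ N) y → InCuspDivN N (+ 1) 1 y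
CuspWithDen⇒InCuspDivN-0 {N} {y} (d , a , _ , ℕD.divides N′ N≡N′d , gcd≡1 , y∈[a/d]) =
  x , coprime⇒valid x-coprime , InCusp-0 {N} {x} (∼-refl {x}) x-coprime v₁⊥N ,
  subst (y ∼_) (sym (trans (divN-pt N (+ N′ ℤ.* u) v₁) (cong (pt (+ N′ ℤ.* u)) (sym N′v≡Nv₁))))
    (∼-scale {y} {u} {v} (+ N′) y∼u/v)
  where
  open Representative (InCusp⇒representative y∈[a/d] (gcd≡1⇒coprime a d gcd≡1))
  v₁ : ℤ
  v₁ = α ℤ.+ j ℤ.* + N′ ℤ.* + N
  x : Pt
  x = pt (+ N′ ℤ.* u) v₁
  N≡N′*d : + N ≡ + N′ ℤ.* + d
  N≡N′*d = trans (cong +_ N≡N′d) (ℤP.pos-* N′ d)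
  factor : ∀ α d j N′ → α ℤ.* d ℤ.+ j ℤ.* (N′ ℤ.* d ℤ.* (N′ ℤ.* d)) ≡
                        d ℤ.* (α ℤ.+ j ℤ.* N′ ℤ.* (N′ ℤ.* d))
  factor = solve-∀ ℤ-ring
  v≡dv₁ : v ≡ + d ℤ.* v₁
  v≡dv₁ = begin
    v                                                      ≡⟨ v≡αd+jM ⟩
    α ℤ.* + d ℤ.+ j ℤ.* + (N * N)
      ≡⟨ cong (λ t → α ℤ.* + d ℤ.+ j ℤ.* t) (trans (ℤP.pos-* N N) (cong₂ ℤ._*_ N≡N′*d N≡N′*d)) ⟩
    α ℤ.* + d ℤ.+ j ℤ.* (+ N′ ℤ.* + d ℤ.* (+ N′ ℤ.* + d))  ≡⟨ factor α (+ d) j (+ N′) ⟩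
    + d ℤ.* (α ℤ.+ j ℤ.* + N′ ℤ.* (+ N′ ℤ.* + d))
      ≡⟨ cong (λ t → + d ℤ.* (α ℤ.+ j ℤ.* + N′ ℤ.* t)) N≡N′*d ⟨
    + d ℤ.* v₁                                             ∎
  N′v≡Nv₁ : + N′ ℤ.* v ≡ + N ℤ.* v₁
  N′v≡Nv₁ = begin
    + N′ ℤ.* v               ≡⟨ cong (+ N′ ℤ.*_) v≡dv₁ ⟩
    + N′ ℤ.* (+ d ℤ.* v₁)    ≡⟨ ℤP.*-assoc (+ N′) (+ d) v₁ ⟨
    + N′ ℤ.* + d ℤ.* v₁      ≡⟨ cong (ℤ._* v₁) N≡N′*d ⟨
    + N ℤ.* v₁               ∎
  v₁⊥N : Coprime v₁ (+ N)
  v₁⊥N = coprime-+* (j ℤ.* + N′) (coprime-∣ʳ α⊥M (divides (+ N) (ℤP.pos-* N N)))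
  x-coprime : Coprime (+ N′ ℤ.* u) v₁
  x-coprime = coprime-sym (coprime-*ʳ (coprime-∣ʳ v₁⊥N (divides (+ d) (trans N≡N′*d (ℤP.*-comm (+ N′) (+ d)))))
                                      (coprime-∣ˡ (coprime-sym u⊥v) (divides (+ d) v≡dv₁)))

ramification-at-0/N : ∀ {N y} → N ≢ 0 → ValidPt y → Reduced-0/N N y → RamIndex (Γ₀ (N * N)) (Γ₀' N) y 1
ramification-at-0/N {N} {y} N≢0 y-valid
  record { u = u ; v = v ; N₁ = N₁ ; g = g ; N≡N₁g = N≡N₁g ; y∼u/N₁v = y∼u/N₁v
         ; u⊥N₁v = u⊥N₁v ; v⊥N = v⊥N ; v⊥u = v⊥u } =
  ℕ→ℚ (g * g) , ℕ→ℚ (g * g) ,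
  IsWidth-transport {Γ₀' N} {Γ₀ (N * N)} {y} from-Γ₀′
    (λ h → TransIn-mono {Γ₀ (N * N)} {Γ₀' N} {y} {h} Γ₀²⊆Γ₀′) width ,
  width ,
  sym (ℚP.*-identityˡ (ℕ→ℚ (g * g)))
  where
  N₁≢0 : N₁ ≢ 0
  N₁≢0 N₁≡0 = N≢0 (trans N≡N₁g (cong (ℕ._* g) N₁≡0))
  g≢0 : g ≢ 0
  g≢0 g≡0 = N≢0 (trans N≡N₁g (trans (cong (N₁ ℕ.*_) g≡0) (ℕP.*-zeroʳ N₁)))
  v⊥g : Coprime v (+ g)
  v⊥g = coprime-∣ʳ v⊥N (divides (+ N₁) (trans (cong +_ N≡N₁g) (ℤP.pos-* N₁ g)))
  square : ∀ n v → n ℤ.* v ℤ.* (n ℤ.* v) ≡ v ℤ.* v ℤ.* (n ℤ.* n)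
  square = solve-∀ ℤ-ring
  N₁v²≡v²N₁² : + N₁ ℤ.* v ℤ.* (+ N₁ ℤ.* v) ≡ v ℤ.* v ℤ.* + (N₁ * N₁)
  N₁v²≡v²N₁² = trans (square (+ N₁) v) (cong (v ℤ.* v ℤ.*_) (sym (ℤP.pos-* N₁ N₁)))
  N²≡N₁²g² : N * N ≡ N₁ * N₁ * (g * g)
  N²≡N₁²g² = begin
    N * N                    ≡⟨ cong₂ _*_ N≡N₁g N≡N₁g ⟩
    N₁ * g * (N₁ * g)        ≡⟨ solve (N₁ ∷ g ∷ []) ℕ-ring ⟩
    N₁ * N₁ * (g * g)        ∎
  width : IsWidth (Γ₀ (N * N)) y (ℕ→ℚ (g * g))
  width = Γ₀-width {N * N} {y} {u} {+ N₁ ℤ.* v} (N₁ * N₁) (g * g) (v ℤ.* v) (*-≢0 N₁≢0 N₁≢0) (*-≢0 g≢0 g≢0)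
            N²≡N₁²g² N₁v²≡v²N₁² (coprime-*ˡ (coprime-N² v⊥g) (coprime-N² v⊥g)) y-valid y∼u/N₁v u⊥N₁v
  from-Γ₀′ : ∀ h → TransIn (Γ₀' N) y h → TransIn (Γ₀ (N * N)) y h
  from-Γ₀′ h h-trans =
    TransIn-intro {Γ₀ (N * N)} {y} y∼u/N₁v u⊥N₁v
      (parabolic∈Γ₀′⇒Γ₀² N≡N₁g N₁≢0 v⊥N v⊥u
        (TransIn-elim {Γ₀' N} {y} {u} {+ N₁ ℤ.* v} {h} (Γ₀′-negClosed {N}) y-valid y∼u/N₁v u⊥N₁v h-trans))

InCusp⇒InCuspDivN-∞ : ∀ {N y} → InCusp (N * N) (+ 1) (N * N) y → InCuspDivN N (+ 1) N y
InCusp⇒InCuspDivN-∞ {N} {y} y∈[1/N²] =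
  let u , v , y∼u/v , u⊥v , N²∣v = InCusp-∞⇒ {N * N} {y} y∈[1/N²] in divide y∼u/v u⊥v N²∣v
  where
  swap : ∀ w n → w ℤ.* (n ℤ.* n) ≡ n ℤ.* (w ℤ.* n)
  swap = solve-∀ ℤ-ring
  divide : ∀ {u v} → y ∼ pt u v → Coprime u v → + (N * N) ∣ᶻ v → InCuspDivN N (+ 1) N y
  divide {u} {v} y∼u/v u⊥v (divides w v≡wN²) =
    pt u (w ℤ.* + N) , coprime⇒valid u⊥wN , InCusp-∞ (∼-refl {pt u (w ℤ.* + N)}) u⊥wN (divides w refl) ,
    subst (y ∼_) (sym (trans (divN-pt N u (w ℤ.* + N)) (cong (pt u) (sym v≡N[wN])))) y∼u/v
    where
    v≡N[wN] : v ≡ + N ℤ.* (w ℤ.* + N)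
    v≡N[wN] = trans v≡wN² (trans (cong (w ℤ.*_) (ℤP.pos-* N N)) (swap w (+ N)))
    u⊥wN : Coprime u (w ℤ.* + N)
    u⊥wN = coprime-∣ʳ u⊥v (divides (+ N) v≡N[wN])

ramification-at-∞/N : ∀ {N y u w} → N ≢ 0 → ValidPt y → y ∼ pt u (w ℤ.* + (N * N)) →
                      Coprime u (w ℤ.* + (N * N)) → RamIndex (Γ₀ (N * N)) (Γ₀' N) y N
ramification-at-∞/N {N} {y} {u} {w} N≢0 y-valid y∼u/v u⊥v =
  ℚ.1/ ℕ→ℚ N , ℕ→ℚ 1 ,
  Γ₀′-width {N} {y} {u} {w} (ℚP.*-inverseʳ (ℕ→ℚ N)) y-valid y∼u/v u⊥v ,
  Γ₀-width {N * N} {y} {u} (N * N) 1 (v ℤ.* w) (*-≢0 N≢0 N≢0) (λ ()) (sym (ℕP.*-identityʳ (N * N)))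
    (sym (ℤP.*-assoc v w (+ (N * N)))) (coprime-1ʳ _) y-valid y∼u/v u⊥v ,
  sym (ℚP.*-inverseʳ (ℕ→ℚ N))
  where
  v : ℤ
  v = w ℤ.* + (N * N)
  instance
    N-nonZero : ℚ.NonZero (ℕ→ℚ N)
    N-nonZero = ℚ.≢-nonZero (λ N≡0 → N≢0 (ℤP.+-injective (ι-injective N≡0)))

lemma3p1 : (N : ℕ) → 1 < N →
    PreimageIs (Γ₀ (N * N)) (Γ₀ N) (InCusp N (+ 1) 1) N (InCusp (N * N) (+ 1) 1)
    × PreimageIs (Γ₀ (N * N)) (Γ₀ N) (InCusp N (+ 1) N) 1 (CuspWithDen (N * N) (λ d → N ∣ d))
    × PreimageIs (Γ₀ (N * N)) (Γ₀' N) (InCuspDivN N (+ 1) 1) 1 (CuspWithDen (N * N) (λ d → d ∣ N))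
    × PreimageIs (Γ₀ (N * N)) (Γ₀' N) (InCuspDivN N (+ 1) N) N (InCusp (N * N) (+ 1) (N * N))
lemma3p1 N 1<N =
  (λ y y-valid →
    mk⇔ (InCusp-0-square {N} {y})
        (Equiv-mono {Γ₀ (N * N)} {Γ₀ N} {y} {frac (+ 1) 1} (Γ₀-mono {N} {N * N} (ℕD.m∣m*n N))) ,
    ramification-at-0 N≢0 y-valid) ,
  (λ y y-valid →
    mk⇔ (λ y∈[1/N] → let u , v , y∼u/v , u⊥v , N∣v = InCusp-∞⇒ {N} {y} y∈[1/N]
                     in CuspWithDen-of-∞ N≢0 y∼u/v u⊥v N∣v)
        CuspWithDen⇒InCusp-∞ ,
    λ y∈[1/N] → let u , v , y∼u/v , u⊥v , N∣v = InCusp-∞⇒ {N} {y} y∈[1/N]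
                in ramification-at-∞ N≢0 y-valid y∼u/v u⊥v N∣v) ,
  (λ y y-valid →
    mk⇔ (CuspWithDen-of-0/N N≢0 ∘ InCuspDivN-0⇒ N≢0) CuspWithDen⇒InCuspDivN-0 ,
    ramification-at-0/N N≢0 y-valid ∘ InCuspDivN-0⇒ N≢0) ,
  (λ y y-valid →
    mk⇔ (λ y∈[1/N]/N → let u , w , y∼u/v , u⊥v = InCuspDivN-∞⇒ {N} {y} N≢0 y∈[1/N]/N
                       in InCusp-∞ {N * N} {y} {u} y∼u/v u⊥v (divides w refl))
        InCusp⇒InCuspDivN-∞ ,
    λ y∈[1/N]/N → let u , w , y∼u/v , u⊥v = InCuspDivN-∞⇒ {N} {y} N≢0 y∈[1/N]/N
                  in ramification-at-∞/N {N} {y} {u} {w} N≢0 y-valid y∼u/v u⊥v)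
  where
  N≢0 : N ≢ 0
  N≢0 = ℕP.m<n⇒n≢0 1<N
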